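{- Let $b\in\mathcal{F}$, let $\mathcal{O}$ be an orbit of binary trees (with at least one vertex), let $T$ be a tree in $\mathcal{O}$, and let $m\ge0$. Then \[\varepsilon_m^{\mathcal{O}}\equiv\sum_{C\in\mathcal{C}_m^{T}}\mathrm{wt}(C)\pmod 2,\] where the sum is over all coin-configurations $C$ on $T$ of order $m$.
   Context: $(\Delta f)(x)=f(x+1)-f(x)$. $\mathcal{F}$ is the set of functions $f:\mathbb{Z}_{\ge0}\to\mathbb{Z}$ with $2^n\mid(\Delta^n f)(x)$ for all $n\ge0$, $x\ge0$. For $f\in\mathcal{F}$ and $n\ge0$, $\Delta^n f$ is constant modulo $2^{n+1}$ and congruent to $0$ or $2^n$; set $\varepsilon_n^f=0$ in the first case and $\varepsilon_n^f=1$ in the second. Write $\varepsilon_k=\varepsilon_k^b$. A binary tree is a rooted tree in which each vertex has possibly a left child and/or a right child. The group $G_n$ acts on binary trees with $n$ vertices, generated by the operations swapping the left and right subtrees at a vertex; an orbit is an orbit of this action. For a binary tree $T$ and $x\in\mathbb{Z}_{\ge0}$ let $w_b(T;x)=\prod_{v\in T}b(x+l_v)$, where $l_v$ is the number of left edges on the path from the root to $v$, and for an orbit $\mathcal{O}$ let $r_b(\mathcal{O};x)=\frac{1}{|\mathcal{O}|}\sum_{T\in\mathcal{O}}w_b(T;x)$. Each $r_b(\mathcal{O};\cdot)$ belongs to $\mathcal{F}$, and $\varepsilon_m^{\mathcal{O}}:=\varepsilon_m^{r_b(\mathcal{O};\cdot)}$. A vertex $u$ is a descendant of an edge $e$ if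 the path from the root to $u$ contains $e$. Two edges are siblings if they go from the same vertex to its two children. A coin-configuration $C$ on $T$ of order $m$ consists of: a set $E$ of edges of $T$ containing no pair of siblings; and an assignment of each coin in the set of distinct coins $\{1,\dots,m\}\cup\{c_e: e\in E\}$ to a vertex of $T$, such that each coin $c_e$ is assigned to a descendant of $e$. Let $C_v$ be the set of coins assigned to vertex $v$, and $\mathrm{wt}(C)=\prod_{v\in T}\varepsilon_{|C_v|}$. $\mathcal{C}_m^T$ is the set of all coin-configurations on $T$ of order $m$. -}

module Defs where

open import Data.Nat as ℕ using (ℕ; zero; suc; _^_)
open import Data.Nat.Properties using (m^n≢0)
open import Data.Integer as ℤ using (ℤ; +_)
open import Data.Integer.DivMod using (_/ℕ_; _%ℕ_)
open import Data.Integer.Divisibility using (_∣_)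
open import Data.Maybe using (Maybe; just; nothing)
open import Data.List using (List; []; _∷_; map; concatMap; _++_; length; foldr; sum)
open import Data.Vec using (Vec; []; _∷_)
open import Data.Product using (_×_; _,_)
open import Data.Bool using (Bool; true; false; if_then_else_)
open import Relation.Binary.PropositionalEquality using (_≡_)
open import Relation.Binary.Construct.Closure.ReflexiveTransitive using (Star)
open import Data.List.Membership.Propositional using (_∈_)
open import Data.List.Relation.Unary.Unique.Propositional using (Unique)

Δ : (ℕ → ℤ) → (ℕ → ℤ)
Δ f x = f (suc x) ℤ.- f x

Δ^ : ℕ → (ℕ → ℤ) → (ℕ → ℤ)
Δ^ zero    f = f
Δ^ (suc n) f = Δ (Δ^ n f)

In𝓕 : (ℕ → ℤ) → Set
In𝓕 f = ∀ n x → (+ (2 ^ n)) ∣ Δ^ n f x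

-- ε_n^f : Δ^n f is constant mod 2^(n+1), congruent to 0 or 2^n;
-- ε_n^f ∈ {0,1} is read off at x = 0:  ((Δ^n f)(0) / 2^n) mod 2.
ε : (ℕ → ℤ) → ℕ → ℕ
ε f n = ((Δ^ n f 0 /ℕ (2 ^ n)) {{m^n≢0 2 n}}) %ℕ 2

data BT : Set where
  node : Maybe BT → Maybe BT → BT

data Pos : BT → Set where
  here : ∀ {l r} → Pos (node l r)
  inL  : ∀ {l r} → Pos l → Pos (node (just l) r)
  inR  : ∀ {l r} → Pos r → Pos (node l (just r))

allPos : (t : BT) → List (Pos t)
allPosL : ∀ (ml mr : Maybe BT) → List (Pos (node ml mr))
allPosR : ∀ (ml mr : Maybe BT) → List (Pos (node ml mr))
allPos (node ml mr) = here ∷ (allPosL ml mr ++ allPosR ml mr)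
allPosL nothing  mr = []
allPosL (just l) mr = map inL (allPos l)
allPosR ml nothing  = []
allPosR ml (just r) = map inR (allPos r)

lefts : ∀ {t} → Pos t → ℕ
lefts here    = 0
lefts (inL p) = suc (lefts p)
lefts (inR p) = lefts p

data Swap : BT → BT → Set where
  swap-here : ∀ {l r} → Swap (node l r) (node r l)
  swap-L    : ∀ {l l′ r} → Swap l l′ → Swap (node (just l) r) (node (just l′) r)
  swap-R    : ∀ {l r r′} → Swap r r′ → Swap (node l (just r)) (node l (just r′))

-- (each generator is an involution, so Star Swap is the orbit relation)
SameOrbit : BT → BT → Set
SameOrbit = Star Swap

IsOrbitOf : List BT → BT → Set
IsOrbitOf O T = Unique O × (∀ T′ → (T′ ∈ O → SameOrbit T T′) × (SameOrbit T T′ → T′ ∈ O))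

prodℤ : List ℤ → ℤ
prodℤ = foldr ℤ._*_ (+ 1)

w : (ℕ → ℤ) → BT → ℕ → ℤ
w b t x = prodℤ (map (λ v → b (x ℕ.+ lefts v)) (allPos t))

sumℤ : List ℤ → ℤ
sumℤ = foldr ℤ._+_ (+ 0)

-- r_b(O;x) = (1/|O|) ∑_{T ∈ O} w_b(T;x)   (exact division: r_b(O;·) ∈ 𝓕)
r : (ℕ → ℤ) → List BT → ℕ → ℤ
r b []       x = + 0
r b (t ∷ ts) x = sumℤ (map (λ t′ → w b t′ x) (t ∷ ts)) /ℕ suc (length ts)

εO : (ℕ → ℤ) → List BT → ℕ → ℕ
εO b O m = ε (r b O) m

-- A coin-configuration of order m on t:
--   coins : placement of the coins 1..m (coin i ↦ vertex)
--   ecoins: for each edge e ∈ E, the pair (e , vertex of c_e), where an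
--           edge is represented by its child endpoint.
record Config (t : BT) (m : ℕ) : Set where
  constructor config
  field
    coins  : Vec (Pos t) m
    ecoins : List (Pos t × Pos t)

allVecs : ∀ {A : Set} → List A → (m : ℕ) → List (Vec A m)
allVecs xs zero    = [] ∷ []
allVecs xs (suc m) = concatMap (λ x → map (x ∷_) (allVecs xs m)) xs

liftL : ∀ {l r} → Pos l × Pos l → Pos (node (just l) r) × Pos (node (just l) r)
liftL (e , v) = inL e , inL v

liftR : ∀ {l r} → Pos r × Pos r → Pos (node l (just r)) × Pos (node l (just r))
liftR (e , v) = inR e , inR v

-- all choices of (E , placement of the coins c_e, e ∈ E):
-- at each vertex choose no child edge, the left child edge, or the right
-- child edge (never both siblings); a chosen edge's coin goes to a vertex
-- of the subtree below that edge.
edgeChoices : (t : BT) → List (List (Pos t × Pos t))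
edgeChoicesL : ∀ (ml mr : Maybe BT) → List (List (Pos (node ml mr) × Pos (node ml mr)))
edgeChoicesR : ∀ (ml mr : Maybe BT) → List (List (Pos (node ml mr) × Pos (node ml mr)))
localChoicesL : ∀ (ml mr : Maybe BT) → List (List (Pos (node ml mr) × Pos (node ml mr)))
localChoicesR : ∀ (ml mr : Maybe BT) → List (List (Pos (node ml mr) × Pos (node ml mr)))
edgeChoices (node ml mr) =
  concatMap (λ here-part →
    concatMap (λ el →
      map (λ er → here-part ++ (el ++ er)) (edgeChoicesR ml mr))
      (edgeChoicesL ml mr))
    (([] ∷ []) ++ (localChoicesL ml mr ++ localChoicesR ml mr))
edgeChoicesL nothing  mr = [] ∷ []
edgeChoicesL (just l) mr = map (map liftL) (edgeChoices l)
edgeChoicesR ml nothing  = [] ∷ []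
edgeChoicesR ml (just r) = map (map liftR) (edgeChoices r)
localChoicesL nothing  mr = []
localChoicesL (just (node a b)) mr = map (λ v → (inL here , inL v) ∷ []) (allPos (node a b))
localChoicesR ml nothing  = []
localChoicesR ml (just (node a b)) = map (λ v → (inR here , inR v) ∷ []) (allPos (node a b))

allConfigs : (t : BT) (m : ℕ) → List (Config t m)
allConfigs t m =
  concatMap (λ cs → map (λ es → config cs es) (edgeChoices t)) (allVecs (allPos t) m)

samePos : ∀ {t} → Pos t → Pos t → Bool
samePos here    here    = true
samePos (inL p) (inL q) = samePos p q
samePos (inR p) (inR q) = samePos p q
samePos _       _       = false

countVec : ∀ {t m} → Pos t → Vec (Pos t) m → ℕ
countVec v []       = 0
countVec v (p ∷ ps) = (if samePos v p then 1 else 0) ℕ.+ countVec v ps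

countE : ∀ {t} → Pos t → List (Pos t × Pos t) → ℕ
countE v []             = 0
countE v ((e , p) ∷ ps) = (if samePos v p then 1 else 0) ℕ.+ countE v ps

coinsAt : ∀ {t m} → Config t m → Pos t → ℕ
coinsAt (config cs es) v = countVec v cs ℕ.+ countE v es

prodℕ : List ℕ → ℕ
prodℕ = foldr ℕ._*_ 1

wt : (ℕ → ℤ) → ∀ {t m} → Config t m → ℕ
wt b {t} C = prodℕ (map (λ v → ε b (coinsAt C v)) (allPos t))

module Submission where

-- Write D f = Δf / 2.  For f ∈ 𝓕, Δ^m f = 2^m Dᵐ f, so ε_m^f is the
-- parity of (Dᵐ f)(0).  Call f ≈ g when f - g ∈ 2𝓕; then D respects ≈ and
-- obeys the Leibniz rule D(fg) ≈ (Df) g + f (Dg).  Hence Dᵐ applied to a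
-- product ∏_v β(k_v) (with β n = Dⁿ b) places m numbered coins on the vertices
-- in all possible ways.  The orbit average ρ_T = r_b(O;·) satisfies the
-- recursion ρ_{node l r} = b (ρ_l ρ_r + Dρ_l ρ_r + ρ_l Dρ_r), and the same
-- recursion is satisfied (mod 2𝓕) by the "edge sum" over sets E of non-sibling
-- edges whose coins c_e are placed below e: the term Dρ_l is exactly one coin
-- below the left child edge.  Evaluating Dᵐ of the edge sum at 0 mod 2 then
-- replaces each β(|C_v|)(0) by ε_{|C_v|} and gives the weighted count.

open import Defs
open import Data.Nat using (ℕ; _%_)
open import Data.Integer using (ℤ)
open import Data.List using (List; map)
open import Data.Nat.ListAction using (sum)
open import Relation.Binary.PropositionalEquality using (_≡_)

open import Data.Nat as ℕ using (zero; suc; _^_)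
import Data.Nat.Properties as ℕP
import Data.Nat.DivMod as ℕD
import Data.List.Properties as LP
open import Data.Integer as ℤ using (+_; -[1+_]; _+_; _*_; -_; _-_; _/ℕ_; _%ℕ_)
import Data.Integer.Properties as ℤP
import Data.Integer.DivMod as ℤD
import Data.Integer.Divisibility as ℤ∣
import Data.Integer.Divisibility.Signed as ℤ∣ₛ
open import Data.Integer.Tactic.RingSolver using (solve-∀)
open import Data.List using ([]; _∷_; _++_; concatMap; cartesianProductWith; length)
open import Data.List.Relation.Unary.All as All using (All; []; _∷_)
import Data.List.Relation.Unary.All.Properties as All
open import Data.List.Relation.Unary.Unique.Propositional using (Unique; []; _∷_)
import Data.List.Relation.Unary.Unique.Propositional.Properties as Unique
open import Data.Vec using (Vec; _∷_)
open import Data.Bool using (true; false; if_then_else_)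
open import Data.Maybe using (Maybe; just; nothing)
open import Data.Empty using (⊥; ⊥-elim)
open import Relation.Nullary using (¬_; Dec; yes; no)
open import Relation.Binary.Construct.Closure.ReflexiveTransitive as Star
  using (Star; _◅_; _◅◅_) renaming (ε to ε*)
open import Data.Sum using (inj₁; inj₂)
open import Data.List.Relation.Binary.Permutation.Propositional using (_↭_; ↭⇒↭ₛ)
open import Data.List.Relation.Binary.Permutation.Propositional.Properties using (↭-length) renaming (map⁺ to ↭-map⁺)
open import Data.List.Relation.Binary.Permutation.Setoid.Properties (ℤP.≡-setoid) using (foldr-commMonoid)
open import Data.List.Membership.Propositional.Properties.WithK using (unique∧set⇒bag)
open import Data.List.Relation.Binary.BagAndSetEquality using (∼bag⇒↭)
open import Function.Bundles using (mk⇔)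
open import Data.List.Membership.Propositional using (_∈_)
open import Data.List.Membership.Propositional.Properties
  using (∈-map⁻; ∈-map⁺; ∈-++⁻; ∈-++⁺ˡ; ∈-++⁺ʳ; ∈-cartesianProductWith⁻; ∈-cartesianProductWith⁺)
import Data.List.Relation.Unary.Any as Any
open import Data.Unit using (⊤; tt)
open import Data.Product using (Σ; _×_; _,_; proj₁; proj₂)
open import Relation.Binary.PropositionalEquality
  using (refl; sym; trans; cong; cong₂; subst; _≢_; module ≡-Reasoning)

two : ℤ
two = + 2

*-/ℕ-cancelˡ : ∀ d .{{_ : ℕ.NonZero d}} y → (+ d * y) /ℕ d ≡ y
*-/ℕ-cancelˡ d (+ k) =
  trans (cong (_/ℕ d) (sym (ℤP.pos-* d k)))
        (cong +_ (trans (cong (ℕ._/ d) (ℕP.*-comm d k)) (ℕD.m*n/n≡m k d)))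
*-/ℕ-cancelˡ (suc d) -[1+ k ] = negative (k ℕ.+ d ℕ.* suc k) refl
  where
  -- -[1+ n ] /ℕ d unfolds by cases on (1 + n) % d, which is 0 here
  negative : ∀ n → suc n ≡ suc d ℕ.* suc k → (-[1+ n ] /ℕ suc d) ≡ -[1+ k ]
  negative n eq with suc n ℕ.% suc d in rem
  ... | zero = cong (λ q → - (+ q))
    (trans (cong (ℕ._/ suc d) (trans eq (ℕP.*-comm (suc d) (suc k)))) (ℕD.m*n/n≡m (suc k) (suc d)))
  ... | suc _ = ⊥-elim (ℕP.0≢1+n (trans (sym (trans (cong (ℕ._% suc d)
    (trans eq (ℕP.*-comm (suc d) (suc k)))) (ℕD.m*n%n≡0 (suc k) (suc d)))) rem))

infix 4 _≡₂_
record _≡₂_ (y z : ℤ) : Set where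
  constructor ≡₂-by
  field
    cofactor : ℤ
    witness  : y ≡ z + two * cofactor

≡₂-refl : ∀ {a} → a ≡₂ a
≡₂-refl {a} = ≡₂-by (+ 0) (sym (ℤP.+-identityʳ a))

≡₂-sym : ∀ {a b} → a ≡₂ b → b ≡₂ a
≡₂-sym {b = b} (≡₂-by h a≡) = ≡₂-by (- h) (trans (cancel b h) (cong (_+ two * - h) (sym a≡)))
  where
  cancel : ∀ b h → b ≡ (b + two * h) + two * - h
  cancel = solve-∀

≡₂-trans : ∀ {a b c} → a ≡₂ b → b ≡₂ c → a ≡₂ c
≡₂-trans {c = c} (≡₂-by h a≡) (≡₂-by k b≡) =
  ≡₂-by (h + k) (trans a≡ (trans (cong (_+ two * h) b≡) (reassoc c h k)))
  where
  reassoc : ∀ c h k → c + two * k + two * h ≡ c + two * (h + k)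
  reassoc = solve-∀

≡₂-+ : ∀ {a b c d} → a ≡₂ b → c ≡₂ d → a + c ≡₂ b + d
≡₂-+ {b = b} {d = d} (≡₂-by h a≡) (≡₂-by k c≡) = ≡₂-by (h + k) (trans (cong₂ _+_ a≡ c≡) (collect b d h k))
  where
  collect : ∀ b d h k → b + two * h + (d + two * k) ≡ b + d + two * (h + k)
  collect = solve-∀

≡₂-* : ∀ {a b c d} → a ≡₂ b → c ≡₂ d → a * c ≡₂ b * d
≡₂-* {b = b} {d = d} (≡₂-by h a≡) (≡₂-by k c≡) =
  ≡₂-by (h * d + b * k + two * h * k) (trans (cong₂ _*_ a≡ c≡) (expand b d h k))
  where
  expand : ∀ b d h k → (b + two * h) * (d + two * k) ≡ b * d + two * (h * d + b * k + two * h * k)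
  expand = solve-∀

≡₂-%ℕ : ∀ y → y ≡₂ + (y %ℕ 2)
≡₂-%ℕ y = ≡₂-by (y /ℕ 2)
  (trans (ℤD.a≡a%ℕn+[a/ℕn]*n y 2) (cong (λ q → + (y %ℕ 2) + q) (ℤP.*-comm (y /ℕ 2) two)))

1≢2* : ∀ t → + 1 ≢ two * t
1≢2* (+ zero) ()
1≢2* (+ suc t) eq =
  ℕP.0≢1+n (trans (ℕP.suc-injective (ℤP.+-injective (trans eq (sym (ℤP.pos-* 2 (suc t))))))
                  (ℕP.+-suc t (t ℕ.+ 0)))
1≢2* -[1+ t ] ()

remainders-≡₂ : ∀ r s → r ℕ.< 2 → s ℕ.< 2 → + r ≡₂ + s → r ≡ s
remainders-≡₂ 0 0 _ _ _ = refl
remainders-≡₂ 1 1 _ _ _ = refl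
remainders-≡₂ 1 0 _ _ (≡₂-by h eq) = ⊥-elim (1≢2* h (trans eq (ℤP.+-identityˡ (two * h))))
remainders-≡₂ 0 1 _ _ (≡₂-by h eq) =
  ⊥-elim (1≢2* (- h) (trans (cancel h) (trans (cong (_- two * h) (sym eq)) (negate h))))
  where
  cancel : ∀ h → + 1 ≡ (+ 1 + two * h) - two * h
  cancel = solve-∀
  negate : ∀ h → + 0 - two * h ≡ two * - h
  negate = solve-∀
remainders-≡₂ (suc (suc _)) _ (ℕ.s≤s (ℕ.s≤s ())) _ _
remainders-≡₂ _ (suc (suc _)) _ (ℕ.s≤s (ℕ.s≤s ())) _

≡₂⇒%ℕ-≡ : ∀ {y z} → y ≡₂ z → y %ℕ 2 ≡ z %ℕ 2
≡₂⇒%ℕ-≡ {y} {z} y≡₂z = remainders-≡₂ _ _ (ℤD.n%ℕd<d y 2) (ℤD.n%ℕd<d z 2)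
  (≡₂-trans (≡₂-sym (≡₂-%ℕ y)) (≡₂-trans y≡₂z (≡₂-%ℕ z)))

≡₂-sumℤ : ∀ {A : Set} (xs : List A) {f g : A → ℤ} → (∀ a → f a ≡₂ g a) → sumℤ (map f xs) ≡₂ sumℤ (map g xs)
≡₂-sumℤ []       f≡₂g = ≡₂-refl
≡₂-sumℤ (a ∷ xs) f≡₂g = ≡₂-+ (f≡₂g a) (≡₂-sumℤ xs f≡₂g)

≡₂-prodℤ : ∀ {A : Set} (xs : List A) {f g : A → ℤ} → (∀ a → f a ≡₂ g a) → prodℤ (map f xs) ≡₂ prodℤ (map g xs)
≡₂-prodℤ []       f≡₂g = ≡₂-refl
≡₂-prodℤ (a ∷ xs) f≡₂g = ≡₂-* (f≡₂g a) (≡₂-prodℤ xs f≡₂g)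

pos-sum : ∀ {A : Set} (xs : List A) (f : A → ℕ) → + (sum (map f xs)) ≡ sumℤ (map (λ a → + f a) xs)
pos-sum []       f = refl
pos-sum (a ∷ xs) f = trans (ℤP.pos-+ (f a) _) (cong (_+_ (+ f a)) (pos-sum xs f))

pos-prod : ∀ {A : Set} (xs : List A) (f : A → ℕ) → + (prodℕ (map f xs)) ≡ prodℤ (map (λ a → + f a) xs)
pos-prod []       f = refl
pos-prod (a ∷ xs) f = trans (ℤP.pos-* (f a) _) (cong (_*_ (+ f a)) (pos-prod xs f))

Fun : Set
Fun = ℕ → ℤ

infix 4 _≐_
_≐_ : Fun → Fun → Set
f ≐ g = ∀ x → f x ≡ g x

-- A constructive description of 𝓕: "f ∈ 𝓕 up to order n" means
-- f (x+1) = f x + 2 g x for some g which is itself in 𝓕 up to order n-1.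
-- Unlike the divisibility definition, this is visibly closed under + and *.
Is𝓕≤ : ℕ → Fun → Set
Is𝓕≤ zero    f = ⊤
Is𝓕≤ (suc n) f = Σ Fun λ g → (∀ x → f (suc x) ≡ f x + two * g x) × Is𝓕≤ n g

Is𝓕 : Fun → Set
Is𝓕 f = ∀ n → Is𝓕≤ n f

Is𝓕≤-resp : ∀ n {f g} → f ≐ g → Is𝓕≤ n f → Is𝓕≤ n g
Is𝓕≤-resp zero    f≐g _ = tt
Is𝓕≤-resp (suc n) f≐g (h , step , h∈) =
  h , (λ x → trans (sym (f≐g (suc x))) (trans (step x) (cong (_+ two * h x) (f≐g x)))) , h∈

Is𝓕≤-lower : ∀ n {f} → Is𝓕≤ (suc n) f → Is𝓕≤ n f
Is𝓕≤-lower zero    _ = tt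
Is𝓕≤-lower (suc n) (g , step , g∈) = g , step , Is𝓕≤-lower n g∈

Is𝓕≤-shift : ∀ n {f} → Is𝓕≤ n f → Is𝓕≤ n (λ x → f (suc x))
Is𝓕≤-shift zero    _ = tt
Is𝓕≤-shift (suc n) (g , step , g∈) = (λ x → g (suc x)) , (λ x → step (suc x)) , Is𝓕≤-shift n g∈

Is𝓕≤-const : ∀ n c → Is𝓕≤ n (λ _ → c)
Is𝓕≤-const zero    c = tt
Is𝓕≤-const (suc n) c = (λ _ → + 0) , (λ _ → sym (ℤP.+-identityʳ c)) , Is𝓕≤-const n (+ 0)

Is𝓕≤-+ : ∀ n {f g} → Is𝓕≤ n f → Is𝓕≤ n g → Is𝓕≤ n (λ x → f x + g x)
Is𝓕≤-+ zero _ _ = tt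
Is𝓕≤-+ (suc n) {f} {g} (f′ , f-step , f′∈) (g′ , g-step , g′∈) =
  (λ x → f′ x + g′ x) ,
  (λ x → trans (cong₂ _+_ (f-step x) (g-step x)) (collect (f x) (f′ x) (g x) (g′ x))) ,
  Is𝓕≤-+ n f′∈ g′∈
  where
  collect : ∀ a a′ c c′ → (a + two * a′) + (c + two * c′) ≡ (a + c) + two * (a′ + c′)
  collect = solve-∀

Is𝓕≤-* : ∀ n {f g} → Is𝓕≤ n f → Is𝓕≤ n g → Is𝓕≤ n (λ x → f x * g x)
Is𝓕≤-* zero _ _ = tt
Is𝓕≤-* (suc n) {f} {g} f∈@(f′ , f-step , f′∈) g∈@(g′ , g-step , g′∈) =
  (λ x → f′ x * g (suc x) + f x * g′ x) ,
  (λ x → trans (cong₂ _*_ (f-step x) (g-step x))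
         (trans (expand (f x) (f′ x) (g x) (g′ x))
                (cong (λ s → f x * g x + two * (f′ x * s + f x * g′ x)) (sym (g-step x))))) ,
  Is𝓕≤-+ n (Is𝓕≤-* n {f′} {λ x → g (suc x)} f′∈ (Is𝓕≤-shift n (Is𝓕≤-lower n {g} g∈)))
           (Is𝓕≤-* n {f} {g′} (Is𝓕≤-lower n f∈) g′∈)
  where
  expand : ∀ a a′ c c′ → (a + two * a′) * (c + two * c′) ≡ a * c + two * (a′ * (c + two * c′) + a * c′)
  expand = solve-∀



Is𝓕-const : ∀ c → Is𝓕 (λ _ → c)
Is𝓕-const c n = Is𝓕≤-const n c

Is𝓕-+ : ∀ {f g} → Is𝓕 f → Is𝓕 g → Is𝓕 (λ x → f x + g x)
Is𝓕-+ f∈ g∈ n = Is𝓕≤-+ n (f∈ n) (g∈ n)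

Is𝓕-* : ∀ {f g} → Is𝓕 f → Is𝓕 g → Is𝓕 (λ x → f x * g x)
Is𝓕-* f∈ g∈ n = Is𝓕≤-* n (f∈ n) (g∈ n)

D : Fun → Fun
D f x = Δ f x /ℕ 2

D-resp : ∀ {f g} → f ≐ g → D f ≐ D g
D-resp f≐g x = cong (_/ℕ 2) (cong₂ _-_ (f≐g (suc x)) (f≐g x))

D-from-step : ∀ {f g} → (∀ x → f (suc x) ≡ f x + two * g x) → D f ≐ g
D-from-step {f} {g} step x = begin
  (f (suc x) - f x) /ℕ 2        ≡⟨ cong (λ y → (y - f x) /ℕ 2) (step x) ⟩
  (f x + two * g x - f x) /ℕ 2  ≡⟨ cong (_/ℕ 2) (cancel (f x) (g x)) ⟩
  (two * g x) /ℕ 2              ≡⟨ *-/ℕ-cancelˡ 2 (g x) ⟩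
  g x                           ∎
  where
  open ≡-Reasoning
  cancel : ∀ a c → a + two * c - a ≡ two * c
  cancel = solve-∀

Is𝓕-step : ∀ {f} → Is𝓕 f → ∀ x → f (suc x) ≡ f x + two * D f x
Is𝓕-step {f} f∈ x with f∈ 1
... | g , step , _ = trans (step x) (cong (λ y → f x + two * y) (sym (D-from-step {f} {g} step x)))

Is𝓕-D : ∀ {f} → Is𝓕 f → Is𝓕 (D f)
Is𝓕-D {f} f∈ n with f∈ (suc n)
... | g , step , g∈ = Is𝓕≤-resp n (λ x → sym (D-from-step {f} {g} step x)) g∈

Δ≐2D : ∀ {f} → Is𝓕 f → Δ f ≐ (λ x → two * D f x)
Δ≐2D {f} f∈ x = trans (cong (_- f x) (Is𝓕-step f∈ x)) (cancel (f x) (D f x))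
  where
  cancel : ∀ a c → a + two * c - a ≡ two * c
  cancel = solve-∀

Dⁿ : ℕ → Fun → Fun
Dⁿ zero    f = f
Dⁿ (suc n) f = D (Dⁿ n f)

Is𝓕-Dⁿ : ∀ n {f} → Is𝓕 f → Is𝓕 (Dⁿ n f)
Is𝓕-Dⁿ zero    f∈ = f∈
Is𝓕-Dⁿ (suc n) f∈ = Is𝓕-D (Is𝓕-Dⁿ n f∈)

Δ^≐2^*Dⁿ : ∀ m {f} → Is𝓕 f → Δ^ m f ≐ (λ x → + (2 ^ m) * Dⁿ m f x)
Δ^≐2^*Dⁿ zero    {f} f∈ x = sym (ℤP.*-identityˡ (f x))
Δ^≐2^*Dⁿ (suc m) {f} f∈ x = begin
  Δ^ m f (suc x) - Δ^ m f x                   ≡⟨ cong₂ _-_ (Δ^≐2^*Dⁿ m f∈ (suc x)) (Δ^≐2^*Dⁿ m f∈ x) ⟩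
  k * Dⁿ m f (suc x) - k * Dⁿ m f x           ≡⟨ factor k (Dⁿ m f (suc x)) (Dⁿ m f x) ⟩
  k * Δ (Dⁿ m f) x                            ≡⟨ cong (k *_) (Δ≐2D (Is𝓕-Dⁿ m f∈) x) ⟩
  k * (two * Dⁿ (suc m) f x)                  ≡⟨ reassoc k (Dⁿ (suc m) f x) ⟩
  (two * k) * Dⁿ (suc m) f x                  ≡⟨ cong (_* Dⁿ (suc m) f x) (sym (ℤP.pos-* 2 (2 ^ m))) ⟩
  + (2 ^ suc m) * Dⁿ (suc m) f x              ∎
  where
  open ≡-Reasoning
  k : ℤ
  k = + (2 ^ m)
  factor : ∀ k a c → k * a - k * c ≡ k * (a - c)
  factor = solve-∀
  reassoc : ∀ k a → k * (two * a) ≡ (two * k) * a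
  reassoc = solve-∀

ε-via-Dⁿ : ∀ {f} → Is𝓕 f → ∀ m → ε f m ≡ Dⁿ m f 0 %ℕ 2
ε-via-Dⁿ f∈ m = cong (_%ℕ 2)
  (trans (cong (λ y → (y /ℕ (2 ^ m)) {{ℕP.m^n≢0 2 m}}) (Δ^≐2^*Dⁿ m f∈ 0))
         (*-/ℕ-cancelˡ (2 ^ m) {{ℕP.m^n≢0 2 m}} _))

Δ^-resp : ∀ n {f g} → f ≐ g → Δ^ n f ≐ Δ^ n g
Δ^-resp zero    f≐g = f≐g
Δ^-resp (suc n) f≐g x = cong₂ _-_ (Δ^-resp n f≐g (suc x)) (Δ^-resp n f≐g x)

Δ^-suc : ∀ n f → Δ^ (suc n) f ≐ Δ^ n (Δ f)
Δ^-suc zero    f x = refl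
Δ^-suc (suc n) f x = cong₂ _-_ (Δ^-suc n f (suc x)) (Δ^-suc n f x)

Δ^-scale : ∀ k n f → Δ^ n (λ x → k * f x) ≐ (λ x → k * Δ^ n f x)
Δ^-scale k zero    f x = refl
Δ^-scale k (suc n) f x =
  trans (cong₂ _-_ (Δ^-scale k n f (suc x)) (Δ^-scale k n f x)) (factor k _ _)
  where
  factor : ∀ k a c → k * a - k * c ≡ k * (a - c)
  factor = solve-∀

ε-resp : ∀ {f g} → f ≐ g → ∀ m → ε f m ≡ ε g m
ε-resp f≐g m = cong (λ y → ((y /ℕ (2 ^ m)) {{ℕP.m^n≢0 2 m}}) %ℕ 2) (Δ^-resp m f≐g 0)

-- The paper's class 𝓕 is contained in Is𝓕: the halved difference of f ∈ 𝓕
-- is again in 𝓕, since 2^(k+1) ∣ Δ^k (Δ f) = 2 · Δ^k (D f).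
In𝓕⇒Is𝓕 : ∀ {f} → In𝓕 f → Is𝓕 f
In𝓕⇒Is𝓕 f∈ zero = tt
In𝓕⇒Is𝓕 {f} f∈ (suc n) = D f , step , In𝓕⇒Is𝓕 Df∈ n
  where
  Δ≡2*D : ∀ x → Δ f x ≡ two * D f x
  Δ≡2*D x with ℤ∣ₛ.∣ᵤ⇒∣ {two} (f∈ 1 x)
  ... | ℤ∣ₛ.divides q eq = trans Δ≡2q (cong (two *_) (sym (trans (cong (_/ℕ 2) Δ≡2q) (*-/ℕ-cancelˡ 2 q))))
    where
    Δ≡2q : Δ f x ≡ two * q
    Δ≡2q = trans eq (ℤP.*-comm q two)
  step : ∀ x → f (suc x) ≡ f x + two * D f x
  step x = trans (restore (f (suc x)) (f x)) (cong (_+_ (f x)) (Δ≡2*D x))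
    where
    restore : ∀ a c → a ≡ c + (a - c)
    restore = solve-∀
  Df∈ : In𝓕 (D f)
  Df∈ k x = ℤ∣.*-cancelˡ-∣ two {+ (2 ^ k)} {Δ^ k (D f) x}
    (subst (ℤ∣._∣ (two * Δ^ k (D f) x)) (ℤP.pos-* 2 (2 ^ k))
      (subst (ℤ∣._∣_ (+ (2 ^ suc k)))
             (trans (Δ^-suc k f x) (trans (Δ^-resp k Δ≡2*D x) (Δ^-scale two k (D f) x)))
             (f∈ (suc k) x)))

-- D is well defined on ≈-classes of 𝓕 and is a derivation there, which is
-- what turns iterated differences into sums over coin placements.
infix 4 _≈_
record _≈_ (f g : Fun) : Set where
  constructor ≈-by
  field
    cofactor    : Fun
    cofactor∈𝓕 : Is𝓕 cofactor
    witness     : ∀ x → f x ≡ g x + two * cofactor x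

≐⇒≈ : ∀ {f g} → f ≐ g → f ≈ g
≐⇒≈ {g = g} f≐g = ≈-by (λ _ → + 0) (Is𝓕-const (+ 0)) (λ x → trans (f≐g x) (sym (ℤP.+-identityʳ (g x))))

≈-refl : ∀ {f} → f ≈ f
≈-refl = ≐⇒≈ (λ _ → refl)

≈-trans : ∀ {f g k} → f ≈ g → g ≈ k → f ≈ k
≈-trans {f} {g} {k} (≈-by h h∈ f≡) (≈-by h′ h′∈ g≡) = ≈-by (λ x → h x + h′ x) (Is𝓕-+ h∈ h′∈)
  (λ x → _≡₂_.witness (≡₂-trans {f x} {g x} {k x} (≡₂-by (h x) (f≡ x)) (≡₂-by (h′ x) (g≡ x))))

≈-+ : ∀ {f g f′ g′} → f ≈ g → f′ ≈ g′ → (λ x → f x + f′ x) ≈ (λ x → g x + g′ x)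
≈-+ {f} {g} {f′} {g′} (≈-by h h∈ f≡) (≈-by h′ h′∈ f′≡) = ≈-by (λ x → h x + h′ x) (Is𝓕-+ h∈ h′∈)
  (λ x → _≡₂_.witness (≡₂-+ {f x} {g x} {f′ x} {g′ x} (≡₂-by (h x) (f≡ x)) (≡₂-by (h′ x) (f′≡ x))))

≈-*ʳ : ∀ {f g k} → Is𝓕 k → f ≈ g → (λ x → f x * k x) ≈ (λ x → g x * k x)
≈-*ʳ {g = g} {k} k∈ (≈-by h h∈ f≡) =
  ≈-by (λ x → h x * k x) (Is𝓕-* h∈ k∈) (λ x → trans (cong (_* k x) (f≡ x)) (distrib (g x) (h x) (k x)))
  where
  distrib : ∀ a c d → (a + two * c) * d ≡ a * d + two * (c * d)
  distrib = solve-∀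

≈-*ˡ : ∀ {f g k} → Is𝓕 k → f ≈ g → (λ x → k x * f x) ≈ (λ x → k x * g x)
≈-*ˡ {f} {g} {k} k∈ f≈g =
  ≈-trans (≐⇒≈ (λ x → ℤP.*-comm (k x) (f x)))
          (≈-trans (≈-*ʳ k∈ f≈g) (≐⇒≈ (λ x → ℤP.*-comm (g x) (k x))))

≈-* : ∀ {f g f′ g′} → Is𝓕 f′ → Is𝓕 g → f ≈ g → f′ ≈ g′ → (λ x → f x * f′ x) ≈ (λ x → g x * g′ x)
≈-* f′∈ g∈ f≈g f′≈g′ = ≈-trans (≈-*ʳ f′∈ f≈g) (≈-*ˡ g∈ f′≈g′)

≈-at : ∀ {f g} → f ≈ g → ∀ x → f x ≡₂ g x
≈-at (≈-by h _ f≡) x = ≡₂-by (h x) (f≡ x)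

≈-D : ∀ {f g} → Is𝓕 g → f ≈ g → D f ≈ D g
≈-D {f} {g} g∈ (≈-by h h∈ f≡) = ≈-by (D h) (Is𝓕-D h∈) λ x →
  trans (cong (_/ℕ 2) (trans (cong₂ _-_ (trans (f≡ (suc x))
                                                 (cong₂ (λ u v → u + two * v) (Is𝓕-step g∈ x) (Is𝓕-step h∈ x)))
                                          (f≡ x))
                             (regroup (g x) (D g x) (h x) (D h x))))
        (*-/ℕ-cancelˡ 2 (D g x + two * D h x))
  where
  regroup : ∀ a a′ c c′ → ((a + two * a′) + two * (c + two * c′)) - (a + two * c) ≡ two * (a′ + two * c′)
  regroup = solve-∀

Dⁿ-≈ : ∀ m {f g} → Is𝓕 g → f ≈ g → Dⁿ m f ≈ Dⁿ m g
Dⁿ-≈ zero    g∈ f≈g = f≈g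
Dⁿ-≈ (suc m) g∈ f≈g = ≈-D (Is𝓕-Dⁿ m g∈) (Dⁿ-≈ m g∈ f≈g)

shift-≈ : ∀ {f} → Is𝓕 f → (λ x → f (suc x)) ≈ f
shift-≈ f∈ = ≈-by _ (Is𝓕-D f∈) (Is𝓕-step f∈)

D-const : ∀ c → D (λ _ → c) ≐ (λ _ → + 0)
D-const c x = cong (_/ℕ 2) (ℤP.+-inverseʳ c)

D-+ : ∀ {f g} → Is𝓕 f → Is𝓕 g → D (λ x → f x + g x) ≐ (λ x → D f x + D g x)
D-+ {f} {g} f∈ g∈ = D-from-step {f = λ x → f x + g x} λ x →
  trans (cong₂ _+_ (Is𝓕-step f∈ x) (Is𝓕-step g∈ x)) (collect (f x) (D f x) (g x) (D g x))
  where
  collect : ∀ a a′ c c′ → (a + two * a′) + (c + two * c′) ≡ (a + c) + two * (a′ + c′)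
  collect = solve-∀

D-* : ∀ {f g} → Is𝓕 f → Is𝓕 g → D (λ x → f x * g x) ≈ (λ x → D f x * g x + f x * D g x)
D-* {f} {g} f∈ g∈ = ≈-trans (≐⇒≈ exact) (≈-+ (≈-*ˡ (Is𝓕-D f∈) (shift-≈ g∈)) ≈-refl)
  where
  expand : ∀ a a′ c c′ → (a + two * a′) * (c + two * c′) ≡ a * c + two * (a′ * (c + two * c′) + a * c′)
  expand = solve-∀
  exact : D (λ x → f x * g x) ≐ (λ x → D f x * g (suc x) + f x * D g x)
  exact = D-from-step {f = λ x → f x * g x} λ x →
    trans (cong₂ _*_ (Is𝓕-step f∈ x) (Is𝓕-step g∈ x))
          (trans (expand (f x) (D f x) (g x) (D g x))
                 (cong (λ s → f x * g x + two * (D f x * s + f x * D g x)) (sym (Is𝓕-step g∈ x))))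

ΣF : ∀ {A : Set} → List A → (A → Fun) → Fun
ΣF xs F x = sumℤ (map (λ a → F a x) xs)

ΠF : ∀ {A : Set} → List A → (A → Fun) → Fun
ΠF xs F x = prodℤ (map (λ a → F a x) xs)

module _ {A : Set} where

  ΣF-congᴬ : ∀ (xs : List A) {F G : A → Fun} → All (λ a → F a ≐ G a) xs → ΣF xs F ≐ ΣF xs G
  ΣF-congᴬ []       []         x = refl
  ΣF-congᴬ (a ∷ xs) (Fa≐ ∷ F≐) x = cong₂ _+_ (Fa≐ x) (ΣF-congᴬ xs F≐ x)

  ΠF-congᴬ : ∀ (xs : List A) {F G : A → Fun} → All (λ a → F a ≐ G a) xs → ΠF xs F ≐ ΠF xs G
  ΠF-congᴬ []       []         x = refl
  ΠF-congᴬ (a ∷ xs) (Fa≐ ∷ F≐) x = cong₂ _*_ (Fa≐ x) (ΠF-congᴬ xs F≐ x)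

  ΣF-cong : ∀ (xs : List A) {F G : A → Fun} → (∀ a → F a ≐ G a) → ΣF xs F ≐ ΣF xs G
  ΣF-cong xs F≐ = ΣF-congᴬ xs (All.universal F≐ xs)

  ΠF-cong : ∀ (xs : List A) {F G : A → Fun} → (∀ a → F a ≐ G a) → ΠF xs F ≐ ΠF xs G
  ΠF-cong xs F≐ = ΠF-congᴬ xs (All.universal F≐ xs)

  Is𝓕-ΣF : ∀ (xs : List A) {F : A → Fun} → (∀ a → Is𝓕 (F a)) → Is𝓕 (ΣF xs F)
  Is𝓕-ΣF []       F∈ = Is𝓕-const (+ 0)
  Is𝓕-ΣF (a ∷ xs) F∈ = Is𝓕-+ (F∈ a) (Is𝓕-ΣF xs F∈)

  Is𝓕-ΠF : ∀ (xs : List A) {F : A → Fun} → (∀ a → Is𝓕 (F a)) → Is𝓕 (ΠF xs F)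
  Is𝓕-ΠF []       F∈ = Is𝓕-const (+ 1)
  Is𝓕-ΠF (a ∷ xs) F∈ = Is𝓕-* (F∈ a) (Is𝓕-ΠF xs F∈)

  ≈-ΣF : ∀ (xs : List A) {F G : A → Fun} → (∀ a → F a ≈ G a) → ΣF xs F ≈ ΣF xs G
  ≈-ΣF []       F≈ = ≈-refl
  ≈-ΣF (a ∷ xs) F≈ = ≈-+ (F≈ a) (≈-ΣF xs F≈)

  D-ΣF : ∀ (xs : List A) {F : A → Fun} → (∀ a → Is𝓕 (F a)) → D (ΣF xs F) ≐ ΣF xs (λ a → D (F a))
  D-ΣF []       F∈ = D-const (+ 0)
  D-ΣF (a ∷ xs) {F} F∈ x = trans (D-+ (F∈ a) (Is𝓕-ΣF xs F∈) x) (cong (_+_ (D (F a) x)) (D-ΣF xs F∈ x))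

  ΣF-*ˡ : ∀ (xs : List A) (c : Fun) (F : A → Fun) → ΣF xs (λ a y → c y * F a y) ≐ (λ y → c y * ΣF xs F y)
  ΣF-*ˡ []       c F x = sym (ℤP.*-zeroʳ (c x))
  ΣF-*ˡ (a ∷ xs) c F x = trans (cong (_+_ (c x * F a x)) (ΣF-*ˡ xs c F x)) (sym (ℤP.*-distribˡ-+ (c x) (F a x) _))

  ΣF-*ʳ : ∀ (xs : List A) (c : Fun) (F : A → Fun) → ΣF xs (λ a y → F a y * c y) ≐ (λ y → ΣF xs F y * c y)
  ΣF-*ʳ []       c F x = sym (ℤP.*-zeroˡ (c x))
  ΣF-*ʳ (a ∷ xs) c F x = trans (cong (_+_ (F a x * c x)) (ΣF-*ʳ xs c F x)) (sym (ℤP.*-distribʳ-+ (c x) (F a x) _))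

  ΣF-++ : ∀ (xs ys : List A) (F : A → Fun) → ΣF (xs ++ ys) F ≐ (λ y → ΣF xs F y + ΣF ys F y)
  ΣF-++ []       ys F x = sym (ℤP.+-identityˡ _)
  ΣF-++ (a ∷ xs) ys F x = trans (cong (_+_ (F a x)) (ΣF-++ xs ys F x)) (sym (ℤP.+-assoc (F a x) _ _))

  ΠF-++ : ∀ (xs ys : List A) (F : A → Fun) → ΠF (xs ++ ys) F ≐ (λ y → ΠF xs F y * ΠF ys F y)
  ΠF-++ []       ys F x = sym (ℤP.*-identityˡ _)
  ΠF-++ (a ∷ xs) ys F x = trans (cong (_*_ (F a x)) (ΠF-++ xs ys F x)) (sym (ℤP.*-assoc (F a x) _ _))

  ΣF-+ : ∀ (xs : List A) (F G : A → Fun) → ΣF xs (λ a y → F a y + G a y) ≐ (λ y → ΣF xs F y + ΣF xs G y)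
  ΣF-+ []       F G x = refl
  ΣF-+ (a ∷ xs) F G x = trans (cong (_+_ (F a x + G a x)) (ΣF-+ xs F G x)) (interchange (F a x) (G a x) _ _)
    where
    interchange : ∀ p q r s → p + q + (r + s) ≡ p + r + (q + s)
    interchange = solve-∀

  ΣF-zero : ∀ (xs : List A) → ΣF xs (λ _ _ → + 0) ≐ (λ _ → + 0)
  ΣF-zero []       x = refl
  ΣF-zero (a ∷ xs) x = trans (ℤP.+-identityˡ _) (ΣF-zero xs x)

module _ {A B : Set} where

  ΣF-map : ∀ (f : A → B) (xs : List A) (F : B → Fun) → ΣF (map f xs) F ≐ ΣF xs (λ a → F (f a))
  ΣF-map f []       F x = refl
  ΣF-map f (a ∷ xs) F x = cong (_+_ (F (f a) x)) (ΣF-map f xs F x)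

  ΠF-map : ∀ (f : A → B) (xs : List A) (F : B → Fun) → ΠF (map f xs) F ≐ ΠF xs (λ a → F (f a))
  ΠF-map f []       F x = refl
  ΠF-map f (a ∷ xs) F x = cong (_*_ (F (f a) x)) (ΠF-map f xs F x)

  ΣF-concatMap : ∀ (f : A → List B) (xs : List A) (F : B → Fun) →
                 ΣF (concatMap f xs) F ≐ ΣF xs (λ a → ΣF (f a) F)
  ΣF-concatMap f []       F x = refl
  ΣF-concatMap f (a ∷ xs) F x =
    trans (ΣF-++ (f a) (concatMap f xs) F x) (cong (_+_ (ΣF (f a) F x)) (ΣF-concatMap f xs F x))

  ΣF-swap : ∀ (xs : List A) (ys : List B) (F : A → B → Fun) →
            ΣF xs (λ a → ΣF ys (F a)) ≐ ΣF ys (λ c → ΣF xs (λ a → F a c))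
  ΣF-swap []       ys F x = sym (ΣF-zero ys x)
  ΣF-swap (a ∷ xs) ys F x =
    trans (cong (_+_ (ΣF ys (F a) x)) (ΣF-swap xs ys F x)) (sym (ΣF-+ ys (F a) (λ c → ΣF xs (λ a′ → F a′ c)) x))

  ΣF-prod : ∀ (xs : List A) (ys : List B) (F : A → Fun) (G : B → Fun) →
            ΣF xs (λ a → ΣF ys (λ c y → F a y * G c y)) ≐ (λ y → ΣF xs F y * ΣF ys G y)
  ΣF-prod xs ys F G x = trans (ΣF-cong xs (λ a → ΣF-*ˡ ys (F a) G) x) (ΣF-*ʳ xs (ΣF ys G) F x)

module _ {A B C : Set} where

  ΣF-cartesianProductWith : (f : A → B → C) (xs : List A) (ys : List B) (F : C → Fun) →
    ΣF (cartesianProductWith f xs ys) F ≐ ΣF xs (λ a → ΣF ys (λ c → F (f a c)))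
  ΣF-cartesianProductWith f []       ys F x = refl
  ΣF-cartesianProductWith f (a ∷ xs) ys F x =
    trans (ΣF-++ (map (f a) ys) _ F x) (cong₂ _+_ (ΣF-map (f a) ys F x) (ΣF-cartesianProductWith f xs ys F x))

  length-cartesianProductWith : (f : A → B → C) (xs : List A) (ys : List B) →
    length (cartesianProductWith f xs ys) ≡ length xs ℕ.* length ys
  length-cartesianProductWith f []       ys = refl
  length-cartesianProductWith f (a ∷ xs) ys =
    trans (LP.length-++ (map (f a) ys)) (cong₂ ℕ._+_ (LP.length-map (f a) ys) (length-cartesianProductWith f xs ys))

sumℤ-↭ : ∀ {xs ys} → xs ↭ ys → sumℤ xs ≡ sumℤ ys
sumℤ-↭ xs↭ys = foldr-commMonoid ℤP.+-0-isCommutativeMonoid (↭⇒↭ₛ xs↭ys)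

samePos-refl : ∀ {t} (p : Pos t) → samePos p p ≡ true
samePos-refl here    = refl
samePos-refl (inL p) = samePos-refl p
samePos-refl (inR p) = samePos-refl p

samePos-sound : ∀ {t} (p q : Pos t) → samePos p q ≡ true → p ≡ q
samePos-sound here    here    _  = refl
samePos-sound (inL p) (inL q) eq = cong inL (samePos-sound p q eq)
samePos-sound (inR p) (inR q) eq = cong inR (samePos-sound p q eq)
samePos-sound here    (inL _) ()
samePos-sound here    (inR _) ()
samePos-sound (inL _) here    ()
samePos-sound (inL _) (inR _) ()
samePos-sound (inR _) here    ()
samePos-sound (inR _) (inL _) ()

side : ∀ {ml mr} → Pos (node ml mr) → ℕ
side here    = 0
side (inL _) = 1
side (inR _) = 2

allPosL-side : ∀ ml mr → All (λ v → side v ≡ 1) (allPosL ml mr)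
allPosL-side nothing  mr = []
allPosL-side (just l) mr = All.map⁺ (All.universal (λ _ → refl) (allPos l))

allPosR-side : ∀ ml mr → All (λ v → side v ≡ 2) (allPosR ml mr)
allPosR-side ml nothing  = []
allPosR-side ml (just r) = All.map⁺ (All.universal (λ _ → refl) (allPos r))

allPos-unique : ∀ t → Unique (allPos t)
allPos-unique (node ml mr) =
  All.++⁺ (All.map here≢ (allPosL-side ml mr)) (All.map here≢ (allPosR-side ml mr))
  ∷ Unique.++⁺ (left ml mr) (right ml mr) disjoint
  where
  here≢ : ∀ {v n} → side v ≡ suc n → here ≢ v
  here≢ side≡ refl = ℕP.0≢1+n side≡
  left : ∀ ml mr → Unique (allPosL ml mr)
  left nothing  mr = []
  left (just l) mr = Unique.map⁺ (λ { refl → refl }) (allPos-unique l)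
  right : ∀ ml mr → Unique (allPosR ml mr)
  right ml nothing  = []
  right ml (just r) = Unique.map⁺ (λ { refl → refl }) (allPos-unique r)
  disjoint : ∀ {v} → ¬ (v ∈ allPosL ml mr × v ∈ allPosR ml mr)
  disjoint (v∈L , v∈R) with trans (sym (All.lookup (allPosL-side ml mr) v∈L)) (All.lookup (allPosR-side ml mr) v∈R)
  ... | ()

countE-++ : ∀ {t} (v : Pos t) xs ys → countE v (xs ++ ys) ≡ countE v xs ℕ.+ countE v ys
countE-++ v []             ys = refl
countE-++ v ((e , p) ∷ xs) ys =
  trans (cong ((if samePos v p then 1 else 0) ℕ.+_) (countE-++ v xs ys))
        (sym (ℕP.+-assoc (if samePos v p then 1 else 0) _ _))

countE-drop-right : ∀ {t} (v : Pos t) hp el er → countE v er ≡ 0 → countE v (hp ++ (el ++ er)) ≡ countE v (hp ++ el)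
countE-drop-right v hp el er er-v = begin
  countE v (hp ++ (el ++ er))                   ≡⟨ countE-++ v hp (el ++ er) ⟩
  countE v hp ℕ.+ countE v (el ++ er)           ≡⟨ cong (countE v hp ℕ.+_) (countE-++ v el er) ⟩
  countE v hp ℕ.+ (countE v el ℕ.+ countE v er) ≡⟨ cong (λ n → countE v hp ℕ.+ (countE v el ℕ.+ n)) er-v ⟩
  countE v hp ℕ.+ (countE v el ℕ.+ 0)           ≡⟨ cong (countE v hp ℕ.+_) (ℕP.+-identityʳ _) ⟩
  countE v hp ℕ.+ countE v el                   ≡⟨ countE-++ v hp el ⟨
  countE v (hp ++ el)                           ∎
  where open ≡-Reasoning

countE-drop-left : ∀ {t} (v : Pos t) hp el er → countE v el ≡ 0 → countE v (hp ++ (el ++ er)) ≡ countE v (hp ++ er)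
countE-drop-left v hp el er el-v = begin
  countE v (hp ++ (el ++ er))                   ≡⟨ countE-++ v hp (el ++ er) ⟩
  countE v hp ℕ.+ countE v (el ++ er)           ≡⟨ cong (countE v hp ℕ.+_) (countE-++ v el er) ⟩
  countE v hp ℕ.+ (countE v el ℕ.+ countE v er) ≡⟨ cong (λ n → countE v hp ℕ.+ (n ℕ.+ countE v er)) el-v ⟩
  countE v hp ℕ.+ countE v er                   ≡⟨ countE-++ v hp er ⟨
  countE v (hp ++ er)                           ∎
  where open ≡-Reasoning

leftCount : ∀ {l r} → Pos (node (just l) r) → List (Pos l × Pos l) → ℕ
leftCount here    _  = 0
leftCount (inL p) xs = countE p xs
leftCount (inR _) _  = 0

rightCount : ∀ {l r} → Pos (node l (just r)) → List (Pos r × Pos r) → ℕ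
rightCount here    _  = 0
rightCount (inL _) _  = 0
rightCount (inR p) xs = countE p xs

countE-liftL : ∀ {l r} (v : Pos (node (just l) r)) xs → countE v (map liftL xs) ≡ leftCount v xs
countE-liftL here    []             = refl
countE-liftL here    (_ ∷ xs)       = countE-liftL here xs
countE-liftL (inL p) []             = refl
countE-liftL (inL p) ((e , q) ∷ xs) = cong ((if samePos p q then 1 else 0) ℕ.+_) (countE-liftL (inL p) xs)
countE-liftL (inR p) []             = refl
countE-liftL (inR p) (_ ∷ xs)       = countE-liftL (inR p) xs

countE-liftR : ∀ {l r} (v : Pos (node l (just r))) xs → countE v (map liftR xs) ≡ rightCount v xs
countE-liftR here    []             = refl
countE-liftR here    (_ ∷ xs)       = countE-liftR here xs
countE-liftR (inL p) []             = refl
countE-liftR (inL p) (_ ∷ xs)       = countE-liftR (inL p) xs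
countE-liftR (inR p) []             = refl
countE-liftR (inR p) ((e , q) ∷ xs) = cong ((if samePos p q then 1 else 0) ℕ.+_) (countE-liftR (inR p) xs)

leftChoice-elsewhere : ∀ ml mr {el} {v : Pos (node ml mr)} →
                       el ∈ edgeChoicesL ml mr → side v ≢ 1 → countE v el ≡ 0
leftChoice-elsewhere nothing  mr (Any.here refl) _ = refl
leftChoice-elsewhere (just l) mr {v = v} el∈ side≢1 with ∈-map⁻ (map liftL) el∈
... | el′ , _ , refl = trans (countE-liftL v el′) (outside v side≢1)
  where
  outside : ∀ v → side v ≢ 1 → leftCount v el′ ≡ 0
  outside here    _      = refl
  outside (inL _) side≢1 = ⊥-elim (side≢1 refl)
  outside (inR _) _      = refl

rightChoice-elsewhere : ∀ ml mr {er} {v : Pos (node ml mr)} →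
                        er ∈ edgeChoicesR ml mr → side v ≢ 2 → countE v er ≡ 0
rightChoice-elsewhere ml nothing  (Any.here refl) _ = refl
rightChoice-elsewhere ml (just r) {v = v} er∈ side≢2 with ∈-map⁻ (map liftR) er∈
... | er′ , _ , refl = trans (countE-liftR v er′) (outside v side≢2)
  where
  outside : ∀ v → side v ≢ 2 → rightCount v er′ ≡ 0
  outside here    _      = refl
  outside (inL _) _      = refl
  outside (inR _) side≢2 = ⊥-elim (side≢2 refl)

rootChoice-root : ∀ ml mr → All (λ hp → countE here hp ≡ 0) ([] ∷ localChoicesL ml mr ++ localChoicesR ml mr)
rootChoice-root ml mr = refl ∷ All.++⁺ (left ml mr) (right ml mr)
  where
  left : ∀ ml mr → All (λ hp → countE here hp ≡ 0) (localChoicesL ml mr)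
  left nothing             mr = []
  left (just (node a c))   mr = All.map⁺ (All.universal (λ _ → refl) (allPos (node a c)))
  right : ∀ ml mr → All (λ hp → countE here hp ≡ 0) (localChoicesR ml mr)
  right ml nothing           = []
  right ml (just (node a c)) = All.map⁺ (All.universal (λ _ → refl) (allPos (node a c)))

_≟ᵀ_ : (s t : BT) → Dec (s ≡ t)
_≟ᴹ_ : (s t : Maybe BT) → Dec (s ≡ t)
nothing ≟ᴹ nothing = yes refl
nothing ≟ᴹ just _  = no (λ ())
just _  ≟ᴹ nothing = no (λ ())
just s  ≟ᴹ just t with s ≟ᵀ t
... | yes refl = yes refl
... | no s≢t   = no (λ { refl → s≢t refl })
node l r ≟ᵀ node l′ r′ with l ≟ᴹ l′ | r ≟ᴹ r′
... | yes refl | yes refl = yes refl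
... | no l≢l′  | _        = no (λ { refl → l≢l′ refl })
... | yes _    | no r≢r′  = no (λ { refl → r≢r′ refl })

open import Data.List.Membership.DecPropositional _≟ᴹ_ using (_∈?_)

orbit : BT → List BT
orbitᴹ : Maybe BT → List (Maybe BT)
orbitᴹ nothing  = nothing ∷ []
orbitᴹ (just t) = map just (orbit t)
orbit (node ml mr) = byCase (mr ∈? orbitᴹ ml)
  where
  byCase : ∀ {P : Set} → Dec P → List BT
  byCase (yes _) = cartesianProductWith node (orbitᴹ ml) (orbitᴹ ml)
  byCase (no _)  = cartesianProductWith node (orbitᴹ ml) (orbitᴹ mr)
                   ++ cartesianProductWith (λ a c → node c a) (orbitᴹ ml) (orbitᴹ mr)

SameOrbitᴹ : Maybe BT → Maybe BT → Set
SameOrbitᴹ nothing  nothing  = ⊤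
SameOrbitᴹ nothing  (just _) = ⊥
SameOrbitᴹ (just _) nothing  = ⊥
SameOrbitᴹ (just s) (just t) = SameOrbit s t

Swap-sym : ∀ {s t} → Swap s t → Swap t s
Swap-sym swap-here  = swap-here
Swap-sym (swap-L σ) = swap-L (Swap-sym σ)
Swap-sym (swap-R σ) = swap-R (Swap-sym σ)

SameOrbit-sym : ∀ {s t} → SameOrbit s t → SameOrbit t s
SameOrbit-sym ε*       = ε*
SameOrbit-sym (σ ◅ σs) = SameOrbit-sym σs ◅◅ (Swap-sym σ ◅ ε*)

SameOrbitᴹ-sym : ∀ {s t} → SameOrbitᴹ s t → SameOrbitᴹ t s
SameOrbitᴹ-sym {nothing} {nothing} _  = tt
SameOrbitᴹ-sym {just _}  {just _}  st = SameOrbit-sym st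

SameOrbitᴹ-trans : ∀ {s t u} → SameOrbitᴹ s t → SameOrbitᴹ t u → SameOrbitᴹ s u
SameOrbitᴹ-trans {nothing} {nothing} {nothing} _  _  = tt
SameOrbitᴹ-trans {just _}  {just _}  {just _}  st tu = st ◅◅ tu

inLeft : ∀ {ml ml′ mr} → SameOrbitᴹ ml ml′ → SameOrbit (node ml mr) (node ml′ mr)
inLeft {nothing} {nothing} _ = ε*
inLeft {just _}  {just _}  σs = Star.gmap (λ t → node (just t) _) swap-L σs

inRight : ∀ {ml mr mr′} → SameOrbitᴹ mr mr′ → SameOrbit (node ml mr) (node ml mr′)
inRight {mr = nothing} {nothing} _ = ε*
inRight {mr = just _}  {just _}  σs = Star.gmap (λ t → node _ (just t)) swap-R σs

orbit-sound : ∀ t {s} → s ∈ orbit t → SameOrbit t s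
orbitᴹ-sound : ∀ ml {s} → s ∈ orbitᴹ ml → SameOrbitᴹ ml s
orbitᴹ-sound nothing  (Any.here refl) = tt
orbitᴹ-sound (just t) s∈ with ∈-map⁻ just s∈
... | s′ , s′∈ , refl = orbit-sound t s′∈
orbit-sound (node ml mr) s∈ with mr ∈? orbitᴹ ml
... | yes mr∈ with ∈-cartesianProductWith⁻ node (orbitᴹ ml) (orbitᴹ ml) s∈
...   | a , c , a∈ , c∈ , refl =
  inLeft (orbitᴹ-sound ml a∈)
  ◅◅ inRight (SameOrbitᴹ-trans (SameOrbitᴹ-sym (orbitᴹ-sound ml mr∈)) (orbitᴹ-sound ml c∈))
orbit-sound (node ml mr) s∈ | no _ with ∈-++⁻ (cartesianProductWith node (orbitᴹ ml) (orbitᴹ mr)) s∈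
... | inj₁ s∈₁ with ∈-cartesianProductWith⁻ node (orbitᴹ ml) (orbitᴹ mr) s∈₁
...   | a , c , a∈ , c∈ , refl = inLeft (orbitᴹ-sound ml a∈) ◅◅ inRight (orbitᴹ-sound mr c∈)
orbit-sound (node ml mr) s∈ | no _ | inj₂ s∈₂
  with ∈-cartesianProductWith⁻ (λ a c → node c a) (orbitᴹ ml) (orbitᴹ mr) s∈₂
...   | a , c , a∈ , c∈ , refl =
  (inLeft (orbitᴹ-sound ml a∈) ◅◅ inRight (orbitᴹ-sound mr c∈)) ◅◅ (swap-here ◅ ε*)

orbit-refl : ∀ t → t ∈ orbit t
orbitᴹ-refl : ∀ ml → ml ∈ orbitᴹ ml
orbitᴹ-refl nothing  = Any.here refl
orbitᴹ-refl (just t) = ∈-map⁺ just (orbit-refl t)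
orbit-refl (node ml mr) with mr ∈? orbitᴹ ml
... | yes mr∈ = ∈-cartesianProductWith⁺ node (orbitᴹ-refl ml) mr∈
... | no _    = ∈-++⁺ˡ (∈-cartesianProductWith⁺ node (orbitᴹ-refl ml) (orbitᴹ-refl mr))

orbit-closed : ∀ t {s s′} → s ∈ orbit t → Swap s s′ → s′ ∈ orbit t
orbitᴹ-closed : ∀ ml {s s′} → just s ∈ orbitᴹ ml → Swap s s′ → just s′ ∈ orbitᴹ ml
orbitᴹ-closed nothing  (Any.here ()) σ
orbitᴹ-closed nothing  (Any.there ()) σ
orbitᴹ-closed (just t) s∈ σ with ∈-map⁻ just s∈
... | s₀ , s₀∈ , refl = ∈-map⁺ just (orbit-closed t s₀∈ σ)
orbit-closed (node ml mr) s∈ σ with mr ∈? orbitᴹ ml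
... | yes mr∈ with ∈-cartesianProductWith⁻ node (orbitᴹ ml) (orbitᴹ ml) s∈
...   | a , c , a∈ , c∈ , refl with σ
...     | swap-here = ∈-cartesianProductWith⁺ node c∈ a∈
...     | swap-L σ′ = ∈-cartesianProductWith⁺ node (orbitᴹ-closed ml a∈ σ′) c∈
...     | swap-R σ′ = ∈-cartesianProductWith⁺ node a∈ (orbitᴹ-closed ml c∈ σ′)
orbit-closed (node ml mr) s∈ σ | no _ with ∈-++⁻ (cartesianProductWith node (orbitᴹ ml) (orbitᴹ mr)) s∈
... | inj₁ s∈₁ with ∈-cartesianProductWith⁻ node (orbitᴹ ml) (orbitᴹ mr) s∈₁
...   | a , c , a∈ , c∈ , refl with σ
...     | swap-here = ∈-++⁺ʳ (cartesianProductWith node (orbitᴹ ml) (orbitᴹ mr))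
                             (∈-cartesianProductWith⁺ (λ a c → node c a) a∈ c∈)
...     | swap-L σ′ = ∈-++⁺ˡ (∈-cartesianProductWith⁺ node (orbitᴹ-closed ml a∈ σ′) c∈)
...     | swap-R σ′ = ∈-++⁺ˡ (∈-cartesianProductWith⁺ node a∈ (orbitᴹ-closed mr c∈ σ′))
orbit-closed (node ml mr) s∈ σ | no _ | inj₂ s∈₂
  with ∈-cartesianProductWith⁻ (λ a c → node c a) (orbitᴹ ml) (orbitᴹ mr) s∈₂
...   | a , c , a∈ , c∈ , refl with σ
...     | swap-here = ∈-++⁺ˡ (∈-cartesianProductWith⁺ node a∈ c∈)
...     | swap-L σ′ = ∈-++⁺ʳ (cartesianProductWith node (orbitᴹ ml) (orbitᴹ mr))
                             (∈-cartesianProductWith⁺ (λ a c → node c a) a∈ (orbitᴹ-closed mr c∈ σ′))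
...     | swap-R σ′ = ∈-++⁺ʳ (cartesianProductWith node (orbitᴹ ml) (orbitᴹ mr))
                             (∈-cartesianProductWith⁺ (λ a c → node c a) (orbitᴹ-closed ml a∈ σ′) c∈)

orbit-complete : ∀ t {s} → SameOrbit t s → s ∈ orbit t
orbit-complete t = walk (orbit-refl t)
  where
  walk : ∀ {s s′} → s ∈ orbit t → Star Swap s s′ → s′ ∈ orbit t
  walk s∈ ε*       = s∈
  walk s∈ (σ ◅ σs) = walk (orbit-closed t s∈ σ) σs

orbitᴹ-complete : ∀ ml {s} → SameOrbitᴹ ml s → s ∈ orbitᴹ ml
orbitᴹ-complete nothing  {nothing} _  = Any.here refl
orbitᴹ-complete (just t) {just s}  σs = ∈-map⁺ just (orbit-complete t σs)

orbit-unique : ∀ t → Unique (orbit t)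
orbitᴹ-unique : ∀ ml → Unique (orbitᴹ ml)
orbitᴹ-unique nothing  = [] ∷ []
orbitᴹ-unique (just t) = Unique.map⁺ (λ { refl → refl }) (orbit-unique t)
orbit-unique (node ml mr) with mr ∈? orbitᴹ ml
... | yes _ = Unique.cartesianProductWith⁺ node node-injective (orbitᴹ-unique ml) (orbitᴹ-unique ml)
  where
  node-injective : ∀ {a c a′ c′} → node a c ≡ node a′ c′ → a ≡ a′ × c ≡ c′
  node-injective refl = refl , refl
... | no mr∉ = Unique.++⁺ (Unique.cartesianProductWith⁺ node node-injective (orbitᴹ-unique ml) (orbitᴹ-unique mr))
                          (Unique.cartesianProductWith⁺ (λ a c → node c a) swapped-injective
                                                        (orbitᴹ-unique ml) (orbitᴹ-unique mr))
                          disjoint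
  where
  node-injective : ∀ {a c a′ c′} → node a c ≡ node a′ c′ → a ≡ a′ × c ≡ c′
  node-injective refl = refl , refl
  swapped-injective : ∀ {a c a′ c′} → node c a ≡ node c′ a′ → a ≡ a′ × c ≡ c′
  swapped-injective refl = refl , refl
  -- node a c = node c′ a′ would put mr's orbit-mate c′ into the orbit of ml
  disjoint : ∀ {s} → ¬ (s ∈ cartesianProductWith node (orbitᴹ ml) (orbitᴹ mr)
                      × s ∈ cartesianProductWith (λ a c → node c a) (orbitᴹ ml) (orbitᴹ mr))
  disjoint (s∈₁ , s∈₂) with ∈-cartesianProductWith⁻ node (orbitᴹ ml) (orbitᴹ mr) s∈₁
                          | ∈-cartesianProductWith⁻ (λ a c → node c a) (orbitᴹ ml) (orbitᴹ mr) s∈₂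
  ... | a , c , a∈ , c∈ , refl | a′ , c′ , a′∈ , c′∈ , refl =
    mr∉ (orbitᴹ-complete ml (SameOrbitᴹ-trans (orbitᴹ-sound ml a∈) (SameOrbitᴹ-sym (orbitᴹ-sound mr c′∈))))

orbit-↭ : ∀ {O T} → IsOrbitOf O T → O ↭ orbit T
orbit-↭ {T = T} (O! , mem) = ∼bag⇒↭ (unique∧set⇒bag O! (orbit-unique T) (λ {s} →
  mk⇔ (λ s∈ → orbit-complete T (proj₁ (mem s) s∈)) (λ s∈ → proj₂ (mem s) (orbit-sound T s∈))))

module Expansion (b : Fun) (b∈𝓕 : Is𝓕 b) where

  -- β n = Dⁿ b; its parity at 0 is ε_n (ε-via-Dⁿ), and D (β n) = β (n+1).
  β : ℕ → Fun
  β n = Dⁿ n b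

  β∈𝓕 : ∀ n → Is𝓕 (β n)
  β∈𝓕 n = Is𝓕-Dⁿ n b∈𝓕

  -- δ u v: the number of coins at v contributed by one coin placed at u.
  δ : ∀ {t} → Pos t → Pos t → ℕ
  δ u v = if samePos v u then 1 else 0

  δ-self : ∀ {t} (u : Pos t) → δ u u ≡ 1
  δ-self u rewrite samePos-refl u = refl

  δ-≢ : ∀ {t} {u v : Pos t} → v ≢ u → δ u v ≡ 0
  δ-≢ {u = u} {v} v≢u with samePos v u in same
  ... | true  = ⊥-elim (v≢u (samePos-sound v u same))
  ... | false = refl

  -- Leibniz rule for a product over distinct vertices (mod 2𝓕): applying D
  -- places one new coin, on each vertex in turn.
  D-ΠF-β : ∀ {t} (vs : List (Pos t)) (h : Pos t → ℕ) → Unique vs →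
           D (ΠF vs (λ v → β (h v))) ≈ ΣF vs (λ u → ΠF vs (λ v → β (h v ℕ.+ δ u v)))
  D-ΠF-β [] h _ = ≐⇒≈ (D-const (+ 1))
  D-ΠF-β (a ∷ vs) h (a∉vs ∷ vs!) =
    ≈-trans (D-* (β∈𝓕 (h a)) (Is𝓕-ΠF vs (λ v → β∈𝓕 (h v))))
    (≈-trans (≈-+ (≈-refl {λ x → β (suc (h a)) x * ΠF vs (λ v → β (h v)) x})
                  (≈-*ˡ (β∈𝓕 (h a)) (D-ΠF-β vs h vs!)))
             (≐⇒≈ λ x → sym (cong₂ _+_ (new-coin-at-a x) (new-coin-elsewhere x))))
    where
    bump : ∀ {u v} → v ≢ u → ∀ n → β (n ℕ.+ δ u v) ≐ β n
    bump v≢u n x = cong (λ k → β k x) (trans (cong (n ℕ.+_) (δ-≢ v≢u)) (ℕP.+-identityʳ n))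
    new-coin-at-a : ∀ x → β (h a ℕ.+ δ a a) x * ΠF vs (λ v → β (h v ℕ.+ δ a v)) x
                        ≡ β (suc (h a)) x * ΠF vs (λ v → β (h v)) x
    new-coin-at-a x = cong₂ _*_
      (cong (λ k → β k x) (trans (cong (h a ℕ.+_) (δ-self a)) (ℕP.+-comm (h a) 1)))
      (ΠF-congᴬ vs (All.map (λ a≢v → bump (λ v≡a → a≢v (sym v≡a)) (h _)) a∉vs) x)
    new-coin-elsewhere : ∀ x → ΣF vs (λ u y → β (h a ℕ.+ δ u a) y * ΠF vs (λ v → β (h v ℕ.+ δ u v)) y) x
                             ≡ β (h a) x * ΣF vs (λ u → ΠF vs (λ v → β (h v ℕ.+ δ u v))) x
    new-coin-elsewhere x =
      trans (ΣF-congᴬ vs (All.map (λ {u} a≢u y → cong (_* ΠF vs (λ v → β (h v ℕ.+ δ u v)) y)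
                                                      (bump a≢u (h a) y)) a∉vs) x)
            (ΣF-*ˡ vs (β (h a)) (λ u → ΠF vs (λ v → β (h v ℕ.+ δ u v))) x)

  edgeSum : (t : BT) → (Pos t → ℕ) → Fun
  edgeSum t k = ΣF (edgeChoices t) (λ es → ΠF (allPos t) (λ v → β (k v ℕ.+ countE v es)))

  edgeSum∈𝓕 : ∀ t k → Is𝓕 (edgeSum t k)
  edgeSum∈𝓕 t k = Is𝓕-ΣF (edgeChoices t) (λ es → Is𝓕-ΠF (allPos t) (λ v → β∈𝓕 (k v ℕ.+ countE v es)))

  edgeSum-resp : ∀ t {k k′} → (∀ v → k v ≡ k′ v) → edgeSum t k ≐ edgeSum t k′
  edgeSum-resp t k≡ = ΣF-cong (edgeChoices t) (λ es → ΠF-cong (allPos t) (λ v x →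
    cong (λ n → β (n ℕ.+ countE v es) x) (k≡ v)))

  D-edgeSum : ∀ t k → D (edgeSum t k) ≈ ΣF (allPos t) (λ u → edgeSum t (λ v → k v ℕ.+ δ u v))
  D-edgeSum t k =
    ≈-trans (≐⇒≈ (D-ΣF (edgeChoices t) (λ es → Is𝓕-ΠF (allPos t) (λ v → β∈𝓕 (k v ℕ.+ countE v es)))))
    (≈-trans (≈-ΣF (edgeChoices t) (λ es → D-ΠF-β (allPos t) (λ v → k v ℕ.+ countE v es) (allPos-unique t)))
    (≐⇒≈ λ x → trans (ΣF-swap (edgeChoices t) (allPos t)
        (λ es u → ΠF (allPos t) (λ v → β ((k v ℕ.+ countE v es) ℕ.+ δ u v))) x)
      (ΣF-cong (allPos t) (λ u → ΣF-cong (edgeChoices t) (λ es → ΠF-cong (allPos t) (λ v y →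
        cong (λ n → β n y) (reorder (k v) (countE v es) (δ u v))))) x)))
    where
    reorder : ∀ a c d → (a ℕ.+ c) ℕ.+ d ≡ (a ℕ.+ d) ℕ.+ c
    reorder a c d = trans (ℕP.+-assoc a c d) (trans (cong (a ℕ.+_) (ℕP.+-comm c d)) (sym (ℕP.+-assoc a d c)))

  Dⁿ-edgeSum : ∀ t m → Dⁿ m (edgeSum t (λ _ → 0)) ≈ ΣF (allVecs (allPos t) m) (λ cs → edgeSum t (λ v → countVec v cs))
  Dⁿ-edgeSum t zero = ≐⇒≈ (λ x → sym (ℤP.+-identityʳ _))
  Dⁿ-edgeSum t (suc m) =
    ≈-trans (≈-D (Is𝓕-ΣF V (λ cs → edgeSum∈𝓕 t (count cs))) (Dⁿ-edgeSum t m))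
    (≈-trans (≐⇒≈ (D-ΣF V (λ cs → edgeSum∈𝓕 t (count cs))))
    (≈-trans (≈-ΣF V (λ cs → D-edgeSum t (count cs)))
    (≐⇒≈ λ x → trans (ΣF-swap V (allPos t) (λ cs u → edgeSum t (λ v → count cs v ℕ.+ δ u v)) x)
      (sym (trans (ΣF-concatMap (λ u → map (u ∷_) V) (allPos t) (λ cs → edgeSum t (count cs)) x)
        (ΣF-cong (allPos t) (λ u y → trans (ΣF-map (u ∷_) V (λ cs → edgeSum t (count cs)) y)
           (ΣF-cong V (λ cs → edgeSum-resp t (λ v → ℕP.+-comm (δ u v) (count cs v))) y)) x))))))
    where
    V : List (Vec (Pos t) m)
    V = allVecs (allPos t) m
    count : ∀ {n} → Vec (Pos t) n → Pos t → ℕ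
    count cs v = countVec v cs

  edgeSumᴹ : Maybe BT → Fun
  edgeSumᴹ nothing  _ = + 1
  edgeSumᴹ (just t)   = edgeSum t (λ _ → 0)

  edgeSumᴹ′ : Maybe BT → Fun
  edgeSumᴹ′ nothing  _ = + 0
  edgeSumᴹ′ (just t)   = ΣF (allPos t) (λ u → edgeSum t (δ u))

  edgeSumᴹ∈𝓕 : ∀ ml → Is𝓕 (edgeSumᴹ ml)
  edgeSumᴹ∈𝓕 nothing  = Is𝓕-const (+ 1)
  edgeSumᴹ∈𝓕 (just t) = edgeSum∈𝓕 t (λ _ → 0)

  edgeSumᴹ′∈𝓕 : ∀ ml → Is𝓕 (edgeSumᴹ′ ml)
  edgeSumᴹ′∈𝓕 nothing  = Is𝓕-const (+ 0)
  edgeSumᴹ′∈𝓕 (just t) = Is𝓕-ΣF (allPos t) (λ u → edgeSum∈𝓕 t (δ u))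

  Edges : BT → Set
  Edges t = List (Pos t × Pos t)

  leftSum : ∀ ml mr → Edges (node ml mr) → Fun
  leftSum nothing  mr hp _ = + 1
  leftSum (just l) mr hp   = edgeSum l (λ p → countE (inL p) hp)

  rightSum : ∀ ml mr → Edges (node ml mr) → Fun
  rightSum ml nothing  hp _ = + 1
  rightSum ml (just r) hp   = edgeSum r (λ p → countE (inR p) hp)

  leftFactor : ∀ ml mr hp →
    ΣF (edgeChoicesL ml mr) (λ el → ΠF (allPosL ml mr) (λ v → β (countE v (hp ++ el)))) ≐ leftSum ml mr hp
  leftFactor nothing  mr hp x = refl
  leftFactor (just l) mr hp x =
    trans (ΣF-map (map liftL) (edgeChoices l) (λ el → ΠF (allPosL (just l) mr) (λ v → β (countE v (hp ++ el)))) x)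
    (ΣF-cong (edgeChoices l) (λ el y → trans (ΠF-map inL (allPos l) (λ v → β (countE v (hp ++ map liftL el))) y)
      (ΠF-cong (allPos l) (λ p z → cong (λ n → β n z)
        (trans (countE-++ (inL p) hp (map liftL el)) (cong (countE (inL p) hp ℕ.+_) (countE-liftL (inL p) el)))) y)) x)

  rightFactor : ∀ ml mr hp →
    ΣF (edgeChoicesR ml mr) (λ er → ΠF (allPosR ml mr) (λ v → β (countE v (hp ++ er)))) ≐ rightSum ml mr hp
  rightFactor ml nothing  hp x = refl
  rightFactor ml (just r) hp x =
    trans (ΣF-map (map liftR) (edgeChoices r) (λ er → ΠF (allPosR ml (just r)) (λ v → β (countE v (hp ++ er)))) x)
    (ΣF-cong (edgeChoices r) (λ er y → trans (ΠF-map inR (allPos r) (λ v → β (countE v (hp ++ map liftR er))) y)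
      (ΠF-cong (allPos r) (λ p z → cong (λ n → β n z)
        (trans (countE-++ (inR p) hp (map liftR er)) (cong (countE (inR p) hp ℕ.+_) (countE-liftR (inR p) er)))) y)) x)

  -- With the root choice hp fixed, the sum over the subtree choices factors:
  -- the root carries no coin (factor β 0 = b), left vertices only see hp ++ el,
  -- and right vertices only see hp ++ er.
  rootChoice-factor : ∀ ml mr hp → countE here hp ≡ 0 →
    ΣF (edgeChoicesL ml mr) (λ el → ΣF (edgeChoicesR ml mr) (λ er →
       ΠF (allPos (node ml mr)) (λ v → β (countE v (hp ++ (el ++ er))))))
    ≐ (λ x → b x * (leftSum ml mr hp x * rightSum ml mr hp x))
  rootChoice-factor ml mr hp hp-root x =
    trans (ΣF-congᴬ ECL (All.tabulate λ el∈ → ΣF-congᴬ ECR (All.tabulate λ er∈ → split el∈ er∈)) x)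
    (trans (ΣF-cong ECL (λ el → ΣF-*ˡ ECR b (λ er y → ΠL el y * ΠR er y)) x)
    (trans (ΣF-*ˡ ECL b (λ el → ΣF ECR (λ er y → ΠL el y * ΠR er y)) x)
    (cong (b x *_) (trans (ΣF-prod ECL ECR ΠL ΠR x) (cong₂ _*_ (leftFactor ml mr hp x) (rightFactor ml mr hp x))))))
    where
    ECL : List (Edges (node ml mr))
    ECL = edgeChoicesL ml mr
    ECR : List (Edges (node ml mr))
    ECR = edgeChoicesR ml mr
    ΠL ΠR : Edges (node ml mr) → Fun
    ΠL el = ΠF (allPosL ml mr) (λ v → β (countE v (hp ++ el)))
    ΠR er = ΠF (allPosR ml mr) (λ v → β (countE v (hp ++ er)))
    1≢2 : 1 ≢ 2
    1≢2 ()
    split : ∀ {el er} → el ∈ ECL → er ∈ ECR →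
            ΠF (allPos (node ml mr)) (λ v → β (countE v (hp ++ (el ++ er)))) ≐ (λ y → b y * (ΠL el y * ΠR er y))
    split {el} {er} el∈ er∈ y = cong₂ _*_ (cong (λ n → β n y) at-root)
      (trans (ΠF-++ (allPosL ml mr) (allPosR ml mr) (λ v → β (countE v (hp ++ (el ++ er)))) y) (cong₂ _*_
        (ΠF-congᴬ (allPosL ml mr) (All.map (λ side≡1 z → cong (λ n → β n z) (countE-drop-right _ hp el er
          (rightChoice-elsewhere ml mr er∈ (λ side≡2 → 1≢2 (trans (sym side≡1) side≡2))))) (allPosL-side ml mr)) y)
        (ΠF-congᴬ (allPosR ml mr) (All.map (λ side≡2 z → cong (λ n → β n z) (countE-drop-left _ hp el er
          (leftChoice-elsewhere ml mr el∈ (λ side≡1 → 1≢2 (trans (sym side≡1) side≡2))))) (allPosR-side ml mr)) y)))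
      where
      at-root : countE here (hp ++ (el ++ er)) ≡ 0
      at-root = trans (countE-++ here hp (el ++ er)) (cong₂ ℕ._+_ hp-root (trans (countE-++ here el er)
        (cong₂ ℕ._+_ (leftChoice-elsewhere ml mr el∈ λ ()) (rightChoice-elsewhere ml mr er∈ λ ()))))

  rootChoice-none : ∀ ml mr → leftSum ml mr [] ≐ edgeSumᴹ ml × rightSum ml mr [] ≐ edgeSumᴹ mr
  rootChoice-none nothing  nothing  = (λ _ → refl) , (λ _ → refl)
  rootChoice-none nothing  (just r) = (λ _ → refl) , (λ _ → refl)
  rootChoice-none (just l) nothing  = (λ _ → refl) , (λ _ → refl)
  rootChoice-none (just l) (just r) = (λ _ → refl) , (λ _ → refl)

  rootChoice-left : ∀ ml mr →
    ΣF (localChoicesL ml mr) (λ hp y → b y * (leftSum ml mr hp y * rightSum ml mr hp y))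
    ≐ (λ y → b y * (edgeSumᴹ′ ml y * edgeSumᴹ mr y))
  rootChoice-left nothing mr x = sym (annihilate (b x) (edgeSumᴹ mr x))
    where
    annihilate : ∀ c z → c * (+ 0 * z) ≡ + 0
    annihilate = solve-∀
  rootChoice-left (just (node a c)) mr x =
    trans (ΣF-map (λ v → (inL here , inL v) ∷ []) (allPos (node a c))
                  (λ hp y → b y * (leftSum (just (node a c)) mr hp y * rightSum (just (node a c)) mr hp y)) x)
    (trans (ΣF-cong (allPos (node a c)) (λ v y → cong (b y *_) (cong₂ _*_
             (edgeSum-resp (node a c) (λ p → ℕP.+-identityʳ (δ v p)) y) (right-untouched mr v y))) x)
    (trans (ΣF-*ˡ (allPos (node a c)) b (λ v y → edgeSum (node a c) (δ v) y * edgeSumᴹ mr y) x)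
           (cong (b x *_) (ΣF-*ʳ (allPos (node a c)) (edgeSumᴹ mr) (λ v → edgeSum (node a c) (δ v)) x))))
    where
    right-untouched : ∀ mr v → rightSum (just (node a c)) mr ((inL here , inL v) ∷ []) ≐ edgeSumᴹ mr
    right-untouched nothing  v _ = refl
    right-untouched (just r) v _ = refl

  rootChoice-right : ∀ ml mr →
    ΣF (localChoicesR ml mr) (λ hp y → b y * (leftSum ml mr hp y * rightSum ml mr hp y))
    ≐ (λ y → b y * (edgeSumᴹ ml y * edgeSumᴹ′ mr y))
  rootChoice-right ml nothing x = sym (annihilate (b x) (edgeSumᴹ ml x))
    where
    annihilate : ∀ c z → c * (z * + 0) ≡ + 0
    annihilate = solve-∀
  rootChoice-right ml (just (node a c)) x =
    trans (ΣF-map (λ v → (inR here , inR v) ∷ []) (allPos (node a c))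
                  (λ hp y → b y * (leftSum ml (just (node a c)) hp y * rightSum ml (just (node a c)) hp y)) x)
    (trans (ΣF-cong (allPos (node a c)) (λ v y → cong (b y *_) (cong₂ _*_
             (left-untouched ml v y) (edgeSum-resp (node a c) (λ p → ℕP.+-identityʳ (δ v p)) y))) x)
    (trans (ΣF-*ˡ (allPos (node a c)) b (λ v y → edgeSumᴹ ml y * edgeSum (node a c) (δ v) y) x)
           (cong (b x *_) (ΣF-*ˡ (allPos (node a c)) (edgeSumᴹ ml) (λ v → edgeSum (node a c) (δ v)) x))))
    where
    left-untouched : ∀ ml v → leftSum ml (just (node a c)) ((inR here , inR v) ∷ []) ≐ edgeSumᴹ ml
    left-untouched nothing  v _ = refl
    left-untouched (just l) v _ = refl

  -- The recursion satisfied by the edge sum at a vertex with subtrees ml, mr: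
  -- the three root choices give  b · (E_l E_r + E_l′ E_r + E_l E_r′).
  edgeSum-node : ∀ ml mr → edgeSum (node ml mr) (λ _ → 0) ≐
    (λ x → b x * (edgeSumᴹ ml x * edgeSumᴹ mr x + edgeSumᴹ′ ml x * edgeSumᴹ mr x + edgeSumᴹ ml x * edgeSumᴹ′ mr x))
  edgeSum-node ml mr x =
    trans (ΣF-concatMap (λ hp → concatMap (λ el → map (λ er → hp ++ (el ++ er)) ECR) ECL) H Π x)
    (trans (ΣF-cong H (λ hp y → trans (ΣF-concatMap (λ el → map (λ er → hp ++ (el ++ er)) ECR) ECL Π y)
              (ΣF-cong ECL (λ el → ΣF-map (λ er → hp ++ (el ++ er)) ECR Π) y)) x)
    (trans (ΣF-congᴬ H (All.map (λ {hp} → rootChoice-factor ml mr hp) (rootChoice-root ml mr)) x)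
    (trans (cong₂ _+_ (cong (b x *_) (cong₂ _*_ (proj₁ (rootChoice-none ml mr) x) (proj₂ (rootChoice-none ml mr) x)))
             (trans (ΣF-++ (localChoicesL ml mr) (localChoicesR ml mr) term x)
                    (cong₂ _+_ (rootChoice-left ml mr x) (rootChoice-right ml mr x))))
     (collect (b x) (edgeSumᴹ ml x) (edgeSumᴹ mr x) (edgeSumᴹ′ ml x) (edgeSumᴹ′ mr x)))))
    where
    ECL : List (Edges (node ml mr))
    ECL = edgeChoicesL ml mr
    ECR : List (Edges (node ml mr))
    ECR = edgeChoicesR ml mr
    H : List (Edges (node ml mr))
    H = ([] ∷ []) ++ (localChoicesL ml mr ++ localChoicesR ml mr)
    Π : Edges (node ml mr) → Fun
    Π es = ΠF (allPos (node ml mr)) (λ v → β (countE v es))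
    term : Edges (node ml mr) → Fun
    term hp y = b y * (leftSum ml mr hp y * rightSum ml mr hp y)
    collect : ∀ c e f e′ f′ → c * (e * f) + (c * (e′ * f) + c * (e * f′)) ≡ c * (e * f + e′ * f + e * f′)
    collect = solve-∀

  -- The orbit average, computed recursively: swapping at the root averages the
  -- two orientations, (ρ_l(x+1) ρ_r(x) + ρ_l(x) ρ_r(x+1)) / 2, which on 𝓕 is
  -- ρ_l ρ_r + Dρ_l ρ_r + ρ_l Dρ_r (an empty subtree contributes 1).
  ρ : BT → Fun
  ρᴹ : Maybe BT → Fun
  ρᴹ nothing  _ = + 1
  ρᴹ (just t)   = ρ t
  ρ (node ml mr) x = b x * (ρᴹ ml x * ρᴹ mr x + D (ρᴹ ml) x * ρᴹ mr x + ρᴹ ml x * D (ρᴹ mr) x)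

  ρ∈𝓕 : ∀ t → Is𝓕 (ρ t)
  ρᴹ∈𝓕 : ∀ ml → Is𝓕 (ρᴹ ml)
  ρᴹ∈𝓕 nothing  = Is𝓕-const (+ 1)
  ρᴹ∈𝓕 (just t) = ρ∈𝓕 t
  ρ∈𝓕 (node ml mr) = Is𝓕-* b∈𝓕 (Is𝓕-+ (Is𝓕-+ (Is𝓕-* l∈ r∈) (Is𝓕-* (Is𝓕-D l∈) r∈)) (Is𝓕-* l∈ (Is𝓕-D r∈)))
    where
    l∈ : Is𝓕 (ρᴹ ml)
    l∈ = ρᴹ∈𝓕 ml
    r∈ : Is𝓕 (ρᴹ mr)
    r∈ = ρᴹ∈𝓕 mr

  -- Modulo 2𝓕 the orbit average equals the edge sum: both satisfy the same
  -- recursion (edgeSum-node), with D ρ matching the one-extra-coin sum.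
  ρ≈edgeSum : ∀ t → ρ t ≈ edgeSum t (λ _ → 0)
  ρᴹ≈edgeSumᴹ : ∀ ml → ρᴹ ml ≈ edgeSumᴹ ml
  Dρᴹ≈edgeSumᴹ′ : ∀ ml → D (ρᴹ ml) ≈ edgeSumᴹ′ ml
  ρᴹ≈edgeSumᴹ nothing  = ≈-refl
  ρᴹ≈edgeSumᴹ (just t) = ρ≈edgeSum t
  Dρᴹ≈edgeSumᴹ′ nothing  = ≐⇒≈ (D-const (+ 1))
  Dρᴹ≈edgeSumᴹ′ (just t) = ≈-trans (≈-D (edgeSum∈𝓕 t (λ _ → 0)) (ρ≈edgeSum t)) (D-edgeSum t (λ _ → 0))
  ρ≈edgeSum (node ml mr) =
    ≈-trans (≈-*ˡ b∈𝓕 (≈-+ (≈-+ (≈-* r∈ (edgeSumᴹ∈𝓕 ml) l≈ r≈) (≈-* r∈ (edgeSumᴹ′∈𝓕 ml) Dl≈ r≈))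
                              (≈-* (Is𝓕-D r∈) (edgeSumᴹ∈𝓕 ml) l≈ Dr≈)))
            (≐⇒≈ (λ x → sym (edgeSum-node ml mr x)))
    where
    r∈ : Is𝓕 (ρᴹ mr)
    r∈ = ρᴹ∈𝓕 mr
    l≈ : ρᴹ ml ≈ edgeSumᴹ ml
    l≈ = ρᴹ≈edgeSumᴹ ml
    r≈ : ρᴹ mr ≈ edgeSumᴹ mr
    r≈ = ρᴹ≈edgeSumᴹ mr
    Dl≈ : D (ρᴹ ml) ≈ edgeSumᴹ′ ml
    Dl≈ = Dρᴹ≈edgeSumᴹ′ ml
    Dr≈ : D (ρᴹ mr) ≈ edgeSumᴹ′ mr
    Dr≈ = Dρᴹ≈edgeSumᴹ′ mr

  β-parity : ∀ n → β n 0 ≡₂ + ε b n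
  β-parity n = subst (λ e → β n 0 ≡₂ + e) (sym (ε-via-Dⁿ b∈𝓕 n)) (≡₂-%ℕ (β n 0))

  configSum : (t : BT) (m : ℕ) → ℤ
  configSum t m = ΣF (allVecs (allPos t) m) (λ cs _ → ΣF (edgeChoices t) (λ es _ →
                    ΠF (allPos t) (λ v _ → + ε b (countVec v cs ℕ.+ countE v es)) 0) 0) 0

  configSum-wt : ∀ t m → + sum (map (wt b) (allConfigs t m)) ≡ configSum t m
  configSum-wt t m =
    trans (pos-sum (allConfigs t m) (wt b))
    (trans (ΣF-concatMap (λ cs → map (config cs) (edgeChoices t)) (allVecs (allPos t) m) (λ C _ → + wt b C) 0)
    (ΣF-cong (allVecs (allPos t) m) (λ cs y → trans (ΣF-map (config cs) (edgeChoices t) (λ C _ → + wt b C) y)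
      (ΣF-cong (edgeChoices t) (λ es z → pos-prod (allPos t) (λ v → ε b (countVec v cs ℕ.+ countE v es))) y)) 0))

  Dⁿρ≡₂configSum : ∀ t m → Dⁿ m (ρ t) 0 ≡₂ configSum t m
  Dⁿρ≡₂configSum t m =
    ≡₂-trans (≈-at (≈-trans (Dⁿ-≈ m (edgeSum∈𝓕 t (λ _ → 0)) (ρ≈edgeSum t)) (Dⁿ-edgeSum t m)) 0)
             (≡₂-sumℤ (allVecs (allPos t) m) λ cs → ≡₂-sumℤ (edgeChoices t) λ es →
                ≡₂-prodℤ (allPos t) λ v → β-parity (countVec v cs ℕ.+ countE v es))

  ε-ρ : ∀ t m → ε (ρ t) m ≡ sum (map (wt b) (allConfigs t m)) % 2
  ε-ρ t m = trans (ε-via-Dⁿ (ρ∈𝓕 t) m)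
    (≡₂⇒%ℕ-≡ (subst (Dⁿ m (ρ t) 0 ≡₂_) (sym (configSum-wt t m)) (Dⁿρ≡₂configSum t m)))

  -- ρ is constant on orbits: the root recursion is symmetric in its subtrees.
  ρ-swap : ∀ {s t} → Swap s t → ρ s ≐ ρ t
  ρ-swap {node ml mr} swap-here x = symmetric (b x) (ρᴹ ml x) (ρᴹ mr x) (D (ρᴹ ml) x) (D (ρᴹ mr) x)
    where
    symmetric : ∀ c A B A′ B′ → c * (A * B + A′ * B + A * B′) ≡ c * (B * A + B′ * A + B * A′)
    symmetric = solve-∀
  ρ-swap {node (just _) mr} (swap-L σ) x =
    cong₂ (λ A A′ → b x * (A * ρᴹ mr x + A′ * ρᴹ mr x + A * D (ρᴹ mr) x)) (ρ-swap σ x) (D-resp (ρ-swap σ) x)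
  ρ-swap {node ml (just _)} (swap-R σ) x =
    cong₂ (λ B B′ → b x * (ρᴹ ml x * B + D (ρᴹ ml) x * B + ρᴹ ml x * B′)) (ρ-swap σ x) (D-resp (ρ-swap σ) x)

  ρᴹ-orbit : ∀ {ml mr} → SameOrbitᴹ ml mr → ρᴹ ml ≐ ρᴹ mr
  ρᴹ-orbit {nothing} {nothing} _  x = refl
  ρᴹ-orbit {just _}  {just _}  σs =
    Star.fold (λ s t → ρ s ≐ ρ t) (λ σ eq x → trans (ρ-swap σ x) (eq x)) (λ _ → refl) σs

  -- The weight of a tree splits at the root; the left subtree sits one left edge deeper.
  wᴹ : Maybe BT → Fun
  wᴹ nothing  _ = + 1
  wᴹ (just t)   = w b t

  w-node : ∀ ml mr x → w b (node ml mr) x ≡ b x * (wᴹ ml (suc x) * wᴹ mr x)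
  w-node ml mr x = cong₂ _*_ (cong b (ℕP.+-identityʳ x))
    (trans (ΠF-++ (allPosL ml mr) (allPosR ml mr) (λ v y → b (y ℕ.+ lefts v)) x) (cong₂ _*_ (left ml mr) (right ml mr)))
    where
    left : ∀ ml mr → ΠF (allPosL ml mr) (λ v y → b (y ℕ.+ lefts v)) x ≡ wᴹ ml (suc x)
    left nothing  mr = refl
    left (just l) mr = trans (ΠF-map inL (allPos l) (λ v y → b (y ℕ.+ lefts v)) x)
                             (ΠF-cong (allPos l) (λ p y → cong b (ℕP.+-suc y (lefts p))) x)
    right : ∀ ml mr → ΠF (allPosR ml mr) (λ v y → b (y ℕ.+ lefts v)) x ≡ wᴹ mr x
    right ml nothing  = refl
    right ml (just r) = ΠF-map inR (allPos r) (λ v y → b (y ℕ.+ lefts v)) x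

  weights-node : ∀ (L R : List (Maybe BT)) →
    ΣF L (λ a → ΣF R (λ c → w b (node a c))) ≐ (λ x → b x * (ΣF L wᴹ (suc x) * ΣF R wᴹ x))
  weights-node L R x =
    trans (ΣF-cong L (λ a → ΣF-cong R (λ c → w-node a c)) x)
    (trans (ΣF-cong L (λ a → ΣF-*ˡ R b (λ c y → wᴹ a (suc y) * wᴹ c y)) x)
    (trans (ΣF-*ˡ L b (λ a → ΣF R (λ c y → wᴹ a (suc y) * wᴹ c y)) x)
           (cong (b x *_) (ΣF-prod L R (λ a y → wᴹ a (suc y)) wᴹ x))))

  OrbitSum : Maybe BT → Set
  OrbitSum ml = ∀ x → ΣF (orbitᴹ ml) wᴹ x ≡ + length (orbitᴹ ml) * ρᴹ ml x

  -- Summing the weights of node a c over a ∈ orbit ml, c ∈ orbit mr, where the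
  -- shifted left sum is expanded through ρ(x+1) = ρ(x) + 2 Dρ(x).
  paired-weights : ∀ ml mr → OrbitSum ml → OrbitSum mr → ∀ x →
    ΣF (orbitᴹ ml) (λ a → ΣF (orbitᴹ mr) (λ c → w b (node a c))) x
    ≡ b x * ((+ length (orbitᴹ ml) * (ρᴹ ml x + two * D (ρᴹ ml) x)) * (+ length (orbitᴹ mr) * ρᴹ mr x))
  paired-weights ml mr sumL sumR x =
    trans (weights-node (orbitᴹ ml) (orbitᴹ mr) x)
          (cong (b x *_) (cong₂ _*_ (trans (sumL (suc x)) (cong (+ length (orbitᴹ ml) *_) (Is𝓕-step (ρᴹ∈𝓕 ml) x)))
                                    (sumR x)))

  orbit-weights-same : ∀ ml mr → SameOrbitᴹ ml mr → OrbitSum ml → ∀ x →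
    ΣF (cartesianProductWith node (orbitᴹ ml) (orbitᴹ ml)) (w b) x
    ≡ + length (cartesianProductWith node (orbitᴹ ml) (orbitᴹ ml)) * ρ (node ml mr) x
  orbit-weights-same ml mr ml~mr sumL x =
    trans (ΣF-cartesianProductWith node L L (w b) x)
    (trans (paired-weights ml ml sumL sumL x)
    (trans (regroup (b x) (+ k) (ρᴹ ml x) (D (ρᴹ ml) x))
           (cong₂ _*_ (trans (sym (ℤP.pos-* k k)) (cong +_ (sym (length-cartesianProductWith node L L))))
                      (cong₂ (λ B B′ → b x * (ρᴹ ml x * B + D (ρᴹ ml) x * B + ρᴹ ml x * B′)) (same x) (D-resp same x)))))
    where
    L : List (Maybe BT)
    L = orbitᴹ ml
    k : ℕ
    k = length L
    same : ρᴹ ml ≐ ρᴹ mr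
    same = ρᴹ-orbit ml~mr
    regroup : ∀ c k A A′ → c * ((k * (A + two * A′)) * (k * A)) ≡ (k * k) * (c * (A * A + A′ * A + A * A′))
    regroup = solve-∀

  orbit-weights-distinct : ∀ ml mr → OrbitSum ml → OrbitSum mr → ∀ x →
    let L = orbitᴹ ml ; R = orbitᴹ mr in
    ΣF (cartesianProductWith node L R ++ cartesianProductWith (λ a c → node c a) L R) (w b) x
    ≡ + length (cartesianProductWith node L R ++ cartesianProductWith (λ a c → node c a) L R) * ρ (node ml mr) x
  orbit-weights-distinct ml mr sumL sumR x =
    trans (ΣF-++ (cartesianProductWith node L R) (cartesianProductWith (λ a c → node c a) L R) (w b) x)
    (trans (cong₂ _+_
      (trans (ΣF-cartesianProductWith node L R (w b) x) (paired-weights ml mr sumL sumR x))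
      (trans (ΣF-cartesianProductWith (λ a c → node c a) L R (w b) x)
             (trans (ΣF-swap L R (λ a c → w b (node c a)) x) (paired-weights mr ml sumR sumL x))))
    (trans (regroup (b x) (+ kl) (+ kr) (ρᴹ ml x) (D (ρᴹ ml) x) (ρᴹ mr x) (D (ρᴹ mr) x))
           (cong (_* ρ (node ml mr) x) size)))
    where
    L : List (Maybe BT)
    L = orbitᴹ ml
    R : List (Maybe BT)
    R = orbitᴹ mr
    kl : ℕ
    kl = length L
    kr : ℕ
    kr = length R
    regroup : ∀ c kl kr A A′ B B′ →
      c * ((kl * (A + two * A′)) * (kr * B)) + c * ((kr * (B + two * B′)) * (kl * A))
      ≡ (kl * kr + kl * kr) * (c * (A * B + A′ * B + A * B′))
    regroup = solve-∀
    size : + kl * + kr + + kl * + kr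
         ≡ + length (cartesianProductWith node L R ++ cartesianProductWith (λ a c → node c a) L R)
    size = trans (cong₂ _+_ (sym (ℤP.pos-* kl kr)) (sym (ℤP.pos-* kl kr))) (trans (sym (ℤP.pos-+ (kl ℕ.* kr) _))
      (cong +_ (sym (trans (LP.length-++ (cartesianProductWith node L R))
        (cong₂ ℕ._+_ (length-cartesianProductWith node L R) (length-cartesianProductWith (λ a c → node c a) L R))))))

  orbit-weights : ∀ t x → ΣF (orbit t) (w b) x ≡ + length (orbit t) * ρ t x
  orbitᴹ-weights : ∀ ml → OrbitSum ml
  orbitᴹ-weights nothing  x = refl
  orbitᴹ-weights (just t) x = trans (ΣF-map just (orbit t) wᴹ x)
    (trans (orbit-weights t x) (cong (λ n → + n * ρ t x) (sym (LP.length-map just (orbit t)))))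
  orbit-weights (node ml mr) x with mr ∈? orbitᴹ ml
  ... | yes mr∈ = orbit-weights-same ml mr (orbitᴹ-sound ml mr∈) (orbitᴹ-weights ml) x
  ... | no _    = orbit-weights-distinct ml mr (orbitᴹ-weights ml) (orbitᴹ-weights mr) x

  r-orbit : ∀ {O T} → IsOrbitOf O T → r b O ≐ ρ T
  r-orbit {[]}     {T} (_ , mem) x with proj₂ (mem T) ε*
  ... | ()
  r-orbit {t ∷ ts} {T} O-orbit x = begin
    ΣF (t ∷ ts) (w b) x /ℕ n                 ≡⟨ cong (_/ℕ n) (sumℤ-↭ (↭-map⁺ (λ s → w b s x) O↭)) ⟩
    ΣF (orbit T) (w b) x /ℕ n                ≡⟨ cong (_/ℕ n) (orbit-weights T x) ⟩
    (+ length (orbit T) * ρ T x) /ℕ n        ≡⟨ cong (λ k → (+ k * ρ T x) /ℕ n) (sym (↭-length O↭)) ⟩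
    (+ n * ρ T x) /ℕ n                       ≡⟨ *-/ℕ-cancelˡ n (ρ T x) ⟩
    ρ T x                                    ∎
    where
    open ≡-Reasoning
    n : ℕ
    n = suc (length ts)
    O↭ : (t ∷ ts) ↭ orbit T
    O↭ = orbit-↭ O-orbit

proposition2p13 : (b : ℕ → ℤ) → In𝓕 b →
    (O : List BT) (T : BT) → IsOrbitOf O T → (m : ℕ) →
    εO b O m ≡ sum (map (wt b) (allConfigs T m)) % 2
proposition2p13 b b∈𝓕 O T O-orbit m = begin
  ε (r b O) m                              ≡⟨ ε-resp (r-orbit O-orbit) m ⟩
  ε (ρ T) m                                ≡⟨ ε-ρ T m ⟩
  sum (map (wt b) (allConfigs T m)) % 2    ∎
  where
  open ≡-Reasoning
  open Expansion b (In𝓕⇒Is𝓕 b∈𝓕)
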